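{- For every integer $n \ge 3$, $\gamma_{MB}(P_3 \square K_{1,n}) = \gamma'_{SMB}(P_3 \square K_{1,n}) = n+2$.
   Context: The Maker-Breaker domination game on a finite graph $G$ is played by Dominator and Staller, who alternately claim a previously unplayed vertex of $G$. Dominator wins as soon as his claimed vertices form a dominating set of $G$; Staller wins as soon as she claims all vertices of some closed neighborhood $N_G[v]$. The D-game is the game where Dominator moves first, the S-game where Staller moves first. $\gamma_{MB}(G)$ is the minimum number of moves Dominator needs to win the D-game when both play optimally (Dominator trying to win as fast as possible, Staller trying to delay), and $\infty$ if Dominator has no winning strategy in the D-game. $\gamma'_{SMB}(G)$ is the minimum number of moves Staller needs to win the S-game when both play optimally (Staller trying to win as fast as possible, Dominator trying to delay), and $\infty$ if Staller has no winning strategy in the S-game. $P_3$ is the path on 3 vertices, $K_{1,n}$ the star with $n$ leaves, and $\square$ the Cartesian product of graphs. -}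

module Defs where

open import Level using (0ℓ)
open import Data.Nat using (ℕ; zero; suc; _+_; _<_)
open import Data.Fin using (Fin; toℕ) renaming (zero to fzero)
import Data.Fin.Properties as FinP
open import Data.Product using (Σ; _×_; _,_; ∃)
open import Data.Product.Properties using (≡-dec)
open import Data.Sum using (_⊎_)
open import Data.Empty using (⊥)
open import Data.Bool using (if_then_else_)
open import Relation.Nullary using (¬_; does)
open import Relation.Binary.PropositionalEquality using (_≡_; _≢_)
open import Relation.Binary.Definitions using (DecidableEquality)

record Graph : Set₁ where
  field
    V    : Set
    _≟_  : DecidableEquality V
    _∼_  : V → V → Set

open Graph public

-- closed neighbourhood membership: u ∈ N[v]
_∈N[_]_ : (G : Graph) → V G → V G → Set
_∈N[_]_ G v u = (u ≡ v) ⊎ _∼_ G v u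

P₃ : Graph
P₃ = record
  { V = Fin 3
  ; _≟_ = FinP._≟_
  ; _∼_ = λ i j → (suc (toℕ i) ≡ toℕ j) ⊎ (suc (toℕ j) ≡ toℕ i)
  }

K₁ : ℕ → Graph
K₁ n = record
  { V = Fin (suc n)
  ; _≟_ = FinP._≟_
  ; _∼_ = λ i j → (i ≡ fzero × j ≢ fzero) ⊎ (j ≡ fzero × i ≢ fzero)
  }

_□_ : Graph → Graph → Graph
G □ H = record
  { V = V G × V H
  ; _≟_ = ≡-dec (_≟_ G) (_≟_ H)
  ; _∼_ = λ { (a , b) (c , d) →
              (a ≡ c × _∼_ H b d) ⊎ (b ≡ d × _∼_ G a c) }
  }

data Owner : Set where
  free dom stal : Owner

module Game (G : Graph) where

  State : Set
  State = V G → Owner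

  empty : State
  empty _ = free

  _[_≔_] : State → V G → Owner → State
  (s [ v ≔ o ]) u = if does (_≟_ G u v) then o else s u

  DomWin : State → Set
  DomWin s = ∀ v → ∃ λ u → G ∈N[ v ] u × s u ≡ dom

  StalWin : State → Set
  StalWin s = ∃ λ v → ∀ u → G ∈N[ v ] u → s u ≡ stal

  -- DTurn k s : Dominator to move in s, and he can force a win using at
  --             most k further moves of his own.
  -- STurn k s : Staller to move in s, and Dominator can force a win using
  --             at most k further moves of his own.
  mutual
    DTurn : ℕ → State → Set
    DTurn zero    s = ⊥
    DTurn (suc k) s = ∃ λ v → s v ≡ free ×
                        (DomWin (s [ v ≔ dom ]) ⊎ STurn k (s [ v ≔ dom ]))

    STurn : ℕ → State → Set
    STurn k s = ∀ w → s w ≡ free →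
                  ¬ StalWin (s [ w ≔ stal ]) × DTurn k (s [ w ≔ stal ])

  -- SMove k s : Staller to move in s, and she can force a win using at
  --             most k further moves of her own.
  -- DReply k s : Dominator to move in s, and Staller can force a win using
  --              at most k further moves of her own.
  mutual
    SMove : ℕ → State → Set
    SMove zero    s = ⊥
    SMove (suc k) s = ∃ λ w → s w ≡ free ×
                        (StalWin (s [ w ≔ stal ]) ⊎ DReply k (s [ w ≔ stal ]))

    DReply : ℕ → State → Set
    DReply k s = ∀ v → s v ≡ free →
                   ¬ DomWin (s [ v ≔ dom ]) × SMove k (s [ v ≔ dom ])

γMB≡ : Graph → ℕ → Set
γMB≡ G k = Game.DTurn G k (Game.empty G)
         × (∀ j → j < k → ¬ Game.DTurn G j (Game.empty G))

γ'SMB≡ : Graph → ℕ → Set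
γ'SMB≡ G k = Game.SMove G k (Game.empty G)
           × (∀ j → j < k → ¬ Game.SMove G j (Game.empty G))

{-# OPTIONS --safe #-}
-- Write the vertices of P₃ □ K₁ n as the centres A, B, C of the three star layers and the
-- columns {la j , lb j , ld j} of leaves. Both upper bounds are explicit strategies: in the
-- D-game Dominator opens with B and then plays a pairing of the leaves, in the S-game Staller
-- opens with A and builds a chain of forcing threats through the la j that ends at B.
-- For the lower bounds the defending player keeps an invariant. Dominator maintains a
-- pairing such that every neighbourhood not containing a pair has more free vertices than
-- Staller has moves left; Staller maintains a family of undominated neighbourhoods with
-- pairwise disjoint free parts, each costing Dominator a separate move, and uses threats to
-- force Dominator's replies.
module Submission where

open import Defs
open import Data.Nat using (ℕ; zero; suc; _+_; _≤_; z≤n; s≤s) renaming (_≟_ to _≟ℕ_)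
open import Data.Nat.Properties using (m≤n⇒m<n∨m≡n; ≤-pred; +-comm; +-identityʳ; m≤m+n)
open import Data.Fin using (Fin; toℕ; punchIn; punchOut) renaming (zero to fz; suc to fs)
open import Data.Fin.Properties using (punchIn-injective; punchInᵢ≢i; punchIn-punchOut; any?; suc-injective)
  renaming (_≟_ to _≟F_)
open import Data.List using (List; []; _∷_; length; allFin)
open import Data.List.Properties using (length-tabulate)
open import Data.List.Membership.Propositional using (_∈_)
open import Data.List.Membership.Propositional.Properties using (∈-allFin)
open import Data.List.Relation.Unary.Any using (here; there)
open import Data.Product using (Σ; _×_; _,_; ∃; proj₁; proj₂)
open import Data.Sum using (_⊎_; inj₁; inj₂)
open import Data.Empty using (⊥; ⊥-elim)
open import Data.Bool using (if_then_else_)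
open import Relation.Nullary using (¬_; Dec; yes; no)
open import Relation.Nullary.Decidable using (dec-true; dec-false; ¬?; _×-dec_; _⊎-dec_)
open import Relation.Binary.PropositionalEquality using (_≡_; _≢_; refl; sym; trans; cong; subst; ≢-sym)

owner-≟ : (a b : Owner) → Dec (a ≡ b)
owner-≟ free free = yes refl
owner-≟ free dom = no (λ ())
owner-≟ free stal = no (λ ())
owner-≟ dom free = no (λ ())
owner-≟ dom dom = yes refl
owner-≟ dom stal = no (λ ())
owner-≟ stal free = no (λ ())
owner-≟ stal dom = no (λ ())
owner-≟ stal stal = yes refl

module GameFacts (G : Graph) where
  open Game G public

  Vertex : Set
  Vertex = V G

  _≟V_ : (a b : Vertex) → Dec (a ≡ b)
  _≟V_ = _≟_ G

  upd-eq : ∀ (s : State) v o → (s [ v ≔ o ]) v ≡ o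
  upd-eq s v o = cong (λ b → if b then o else s v) (dec-true (v ≟V v) refl)

  upd-neq : ∀ (s : State) {v} o {u} → u ≢ v → (s [ v ≔ o ]) u ≡ s u
  upd-neq s {v} o {u} ne = cong (λ b → if b then o else s u) (dec-false (u ≟V v) ne)

  upd-cases : ∀ (s : State) v o u → ((u ≡ v) × (s [ v ≔ o ]) u ≡ o) ⊎ ((u ≢ v) × (s [ v ≔ o ]) u ≡ s u)
  upd-cases s v o u = aux (u ≟V v)
    where
    aux : Dec (u ≡ v) → ((u ≡ v) × (s [ v ≔ o ]) u ≡ o) ⊎ ((u ≢ v) × (s [ v ≔ o ]) u ≡ s u)
    aux (yes p) = inj₁ (p , subst (λ x → (s [ v ≔ o ]) x ≡ o) (sym p) (upd-eq s v o))
    aux (no ne) = inj₂ (ne , upd-neq s {v} o {u} ne)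

  _≗_ : State → State → Set
  s ≗ t = ∀ u → s u ≡ t u

  upd-ext : ∀ {s t} → s ≗ t → ∀ v o → (s [ v ≔ o ]) ≗ (t [ v ≔ o ])
  upd-ext {s} {t} e v o u with upd-cases s v o u | upd-cases t v o u
  ... | inj₁ (_ , p) | inj₁ (_ , q) = trans p (sym q)
  ... | inj₁ (x , _) | inj₂ (y , _) = ⊥-elim (y x)
  ... | inj₂ (x , _) | inj₁ (y , _) = ⊥-elim (x y)
  ... | inj₂ (_ , p) | inj₂ (_ , q) = trans p (trans (e u) (sym q))

  DomWin-ext : ∀ {s t} → s ≗ t → DomWin s → DomWin t
  DomWin-ext e d v with d v
  ... | u , h , p = u , h , trans (sym (e u)) p

  StalWin-ext : ∀ {s t} → s ≗ t → StalWin s → StalWin t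
  StalWin-ext e (v , f) = v , λ u h → trans (sym (e u)) (f u h)

  ≗-sym : ∀ {s t} → s ≗ t → t ≗ s
  ≗-sym e u = sym (e u)

  mutual
    DTurn-ext : ∀ k {s t} → s ≗ t → DTurn k s → DTurn k t
    DTurn-ext (suc k) e (v , fr , inj₁ w) = v , trans (sym (e v)) fr , inj₁ (DomWin-ext (upd-ext e v dom) w)
    DTurn-ext (suc k) e (v , fr , inj₂ w) = v , trans (sym (e v)) fr , inj₂ (STurn-ext k (upd-ext e v dom) w)

    STurn-ext : ∀ k {s t} → s ≗ t → STurn k s → STurn k t
    STurn-ext k e st w fr with st w (trans (e w) fr)
    ... | nw , d = (λ sw → nw (StalWin-ext (≗-sym (upd-ext e w stal)) sw)) , DTurn-ext k (upd-ext e w stal) d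

  mutual
    SMove-ext : ∀ k {s t} → s ≗ t → SMove k s → SMove k t
    SMove-ext (suc k) e (v , fr , inj₁ w) = v , trans (sym (e v)) fr , inj₁ (StalWin-ext (upd-ext e v stal) w)
    SMove-ext (suc k) e (v , fr , inj₂ w) = v , trans (sym (e v)) fr , inj₂ (DReply-ext k (upd-ext e v stal) w)

    DReply-ext : ∀ k {s t} → s ≗ t → DReply k s → DReply k t
    DReply-ext k e st w fr with st w (trans (e w) fr)
    ... | nw , d = (λ sw → nw (DomWin-ext (≗-sym (upd-ext e w dom)) sw)) , SMove-ext k (upd-ext e w dom) d

  mutual
    DTurn-mono : ∀ k {s} → DTurn k s → DTurn (suc k) s
    DTurn-mono (suc k) (v , fr , inj₁ w) = v , fr , inj₁ w
    DTurn-mono (suc k) (v , fr , inj₂ w) = v , fr , inj₂ (STurn-mono k w)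

    STurn-mono : ∀ k {s} → STurn k s → STurn (suc k) s
    STurn-mono k st w fr with st w fr
    ... | nw , d = nw , DTurn-mono k d

  mutual
    SMove-mono : ∀ k {s} → SMove k s → SMove (suc k) s
    SMove-mono (suc k) (v , fr , inj₁ w) = v , fr , inj₁ w
    SMove-mono (suc k) (v , fr , inj₂ w) = v , fr , inj₂ (DReply-mono k w)

    DReply-mono : ∀ k {s} → DReply k s → DReply (suc k) s
    DReply-mono k st w fr with st w fr
    ... | nw , d = nw , SMove-mono k d

  DTurn-≤ : ∀ {j} k {s} → j ≤ k → DTurn j s → DTurn k s
  DTurn-≤ zero z≤n d = d
  DTurn-≤ (suc k) le d with m≤n⇒m<n∨m≡n le
  ... | inj₂ refl = d
  ... | inj₁ (s≤s lt) = DTurn-mono k (DTurn-≤ k lt d)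

  SMove-≤ : ∀ {j} k {s} → j ≤ k → SMove j s → SMove k s
  SMove-≤ zero z≤n d = d
  SMove-≤ (suc k) le d with m≤n⇒m<n∨m≡n le
  ... | inj₂ refl = d
  ... | inj₁ (s≤s lt) = SMove-mono k (SMove-≤ k lt d)

  NotSTurn : ℕ → State → Set
  NotSTurn k s = ∃ λ w → s w ≡ free × (StalWin (s [ w ≔ stal ]) ⊎ ¬ DTurn k (s [ w ≔ stal ]))

  NotSTurn⇒¬STurn : ∀ {k s} → NotSTurn k s → ¬ STurn k s
  NotSTurn⇒¬STurn (w , fr , inj₁ sw) st = proj₁ (st w fr) sw
  NotSTurn⇒¬STurn (w , fr , inj₂ nd) st = nd (proj₂ (st w fr))

  ¬DTurn-suc : ∀ {k s} → (∀ v → s v ≡ free → ¬ DomWin (s [ v ≔ dom ]) × NotSTurn k (s [ v ≔ dom ])) → ¬ DTurn (suc k) s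
  ¬DTurn-suc f (v , fr , inj₁ dw) = proj₁ (f v fr) dw
  ¬DTurn-suc f (v , fr , inj₂ st) = NotSTurn⇒¬STurn (proj₂ (f v fr)) st

  NotDReply : ℕ → State → Set
  NotDReply k s = ∃ λ v → s v ≡ free × (DomWin (s [ v ≔ dom ]) ⊎ ¬ SMove k (s [ v ≔ dom ]))

  NotDReply⇒¬DReply : ∀ {k s} → NotDReply k s → ¬ DReply k s
  NotDReply⇒¬DReply (v , fr , inj₁ dw) dr = proj₁ (dr v fr) dw
  NotDReply⇒¬DReply (v , fr , inj₂ ns) dr = ns (proj₂ (dr v fr))

  ¬SMove-suc : ∀ {k s} → (∀ w → s w ≡ free → ¬ StalWin (s [ w ≔ stal ]) × NotDReply k (s [ w ≔ stal ])) → ¬ SMove (suc k) s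
  ¬SMove-suc f (w , fr , inj₁ sw) = proj₁ (f w fr) sw
  ¬SMove-suc f (w , fr , inj₂ dr) = NotDReply⇒¬DReply (proj₂ (f w fr)) dr

  ¬DTurn-≤ : ∀ {j} k {s} → j ≤ k → ¬ DTurn k s → ¬ DTurn j s
  ¬DTurn-≤ k le nd d = nd (DTurn-≤ k le d)

  ¬SMove-≤ : ∀ {j} k {s} → j ≤ k → ¬ SMove k s → ¬ SMove j s
  ¬SMove-≤ k le nd d = nd (SMove-≤ k le d)

  γMB≡-from-bounds : ∀ k → DTurn (suc k) empty → ¬ DTurn k empty → γMB≡ G (suc k)
  γMB≡-from-bounds k win ¬win = win , λ j j<1+k → ¬DTurn-≤ k (≤-pred j<1+k) ¬win

  γ'SMB≡-from-bounds : ∀ k → SMove (suc k) empty → ¬ SMove k empty → γ'SMB≡ G (suc k)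
  γ'SMB≡-from-bounds k win ¬win = win , λ j j<1+k → ¬SMove-≤ k (≤-pred j<1+k) ¬win

  module Automorphism (σ : Vertex → Vertex) (inv : ∀ u → σ (σ u) ≡ u)
             (pres : ∀ v u → G ∈N[ v ] u → G ∈N[ σ v ] (σ u)) where

    _∘σ : State → State
    (s ∘σ) u = s (σ u)

    σ-inj : ∀ {a b} → σ a ≡ σ b → a ≡ b
    σ-inj {a} {b} e = trans (sym (inv a)) (trans (cong σ e) (inv b))

    upd-∘σ : ∀ s v o → ((s ∘σ) [ v ≔ o ]) ≗ ((s [ σ v ≔ o ]) ∘σ)
    upd-∘σ s v o u with upd-cases (s ∘σ) v o u | upd-cases s (σ v) o (σ u)
    ... | inj₁ (_ , p) | inj₁ (_ , q) = trans p (sym q)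
    ... | inj₁ (x , _) | inj₂ (y , _) = ⊥-elim (y (cong σ x))
    ... | inj₂ (x , _) | inj₁ (y , _) = ⊥-elim (x (σ-inj y))
    ... | inj₂ (_ , p) | inj₂ (_ , q) = trans p (sym q)

    pres⁻¹ : ∀ v u → G ∈N[ σ v ] u → G ∈N[ v ] (σ u)
    pres⁻¹ v u h = subst (λ x → G ∈N[ x ] (σ u)) (inv v) (pres (σ v) u h)

    DomWin-σ : ∀ {s} → DomWin s → DomWin (s ∘σ)
    DomWin-σ {s} d v with d (σ v)
    ... | u , h , p = σ u , pres⁻¹ v u h , trans (cong s (inv u)) p

    StalWin-σ : ∀ {s} → StalWin s → StalWin (s ∘σ)
    StalWin-σ {s} (v , f) = σ v , λ u h → f (σ u) (subst (λ x → G ∈N[ x ] (σ u)) (inv v) (pres (σ v) u h))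

    ∘σ-∘σ : ∀ s → ((s ∘σ) ∘σ) ≗ s
    ∘σ-∘σ s u = cong s (inv u)

    StalWin-σ⁻ : ∀ {s} → StalWin (s ∘σ) → StalWin s
    StalWin-σ⁻ {s} w = StalWin-ext (∘σ-∘σ s) (StalWin-σ w)

    DomWin-σ⁻ : ∀ {s} → DomWin (s ∘σ) → DomWin s
    DomWin-σ⁻ {s} w = DomWin-ext (∘σ-∘σ s) (DomWin-σ w)

    upd-σ-∘σ : ∀ s v o → ((s ∘σ) [ σ v ≔ o ]) ≗ ((s [ v ≔ o ]) ∘σ)
    upd-σ-∘σ s v o u = trans (upd-∘σ s (σ v) o u) (cong (λ y → (s [ y ≔ o ]) (σ u)) (inv v))

    mutual
      DTurn-σ : ∀ k {s} → DTurn k s → DTurn k (s ∘σ)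
      DTurn-σ (suc k) {s} (v , fr , inj₁ w) =
        σ v , trans (cong s (inv v)) fr , inj₁ (DomWin-ext (≗-sym (upd-σ-∘σ s v dom)) (DomWin-σ w))
      DTurn-σ (suc k) {s} (v , fr , inj₂ w) =
        σ v , trans (cong s (inv v)) fr , inj₂ (STurn-ext k (≗-sym (upd-σ-∘σ s v dom)) (STurn-σ k w))

      STurn-σ : ∀ k {s} → STurn k s → STurn k (s ∘σ)
      STurn-σ k {s} st w fr with st (σ w) fr
      ... | nw , d = (λ sw → nw (StalWin-σ⁻ (StalWin-ext (upd-∘σ s w stal) sw))) ,
                     DTurn-ext k (≗-sym (upd-∘σ s w stal)) (DTurn-σ k d)

    mutual
      SMove-σ : ∀ k {s} → SMove k s → SMove k (s ∘σ)
      SMove-σ (suc k) {s} (v , fr , inj₁ w) =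
        σ v , trans (cong s (inv v)) fr , inj₁ (StalWin-ext (≗-sym (upd-σ-∘σ s v stal)) (StalWin-σ w))
      SMove-σ (suc k) {s} (v , fr , inj₂ w) =
        σ v , trans (cong s (inv v)) fr , inj₂ (DReply-ext k (≗-sym (upd-σ-∘σ s v stal)) (DReply-σ k w))

      DReply-σ : ∀ k {s} → DReply k s → DReply k (s ∘σ)
      DReply-σ k {s} st w fr with st (σ w) fr
      ... | nw , d = (λ sw → nw (DomWin-σ⁻ (DomWin-ext (upd-∘σ s w dom) sw))) ,
                     SMove-ext k (≗-sym (upd-∘σ s w dom)) (SMove-σ k d)

    ¬SMove-σ : ∀ k {s t} → t ≗ (s ∘σ) → ¬ SMove k s → ¬ SMove k t
    ¬SMove-σ k {s} {t} e ns sm = ns (SMove-ext k (∘σ-∘σ s) (SMove-σ k (SMove-ext k e sm)))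

    NotDReply-σ : ∀ k {s t} → t ≗ (s ∘σ) → NotDReply k s → NotDReply k t
    NotDReply-σ k {s} {t} e (y , fy , r) = σ y , trans (e (σ y)) (trans (cong s (inv y)) fy) , r' r
      where
      e' : (t [ σ y ≔ dom ]) ≗ ((s [ y ≔ dom ]) ∘σ)
      e' u = trans (upd-ext e (σ y) dom u) (upd-σ-∘σ s y dom u)
      r' : DomWin (s [ y ≔ dom ]) ⊎ ¬ SMove k (s [ y ≔ dom ]) → DomWin (t [ σ y ≔ dom ]) ⊎ ¬ SMove k (t [ σ y ≔ dom ])
      r' (inj₁ dw) = inj₁ (DomWin-ext (≗-sym e') (DomWin-σ dw))
      r' (inj₂ ns) = inj₂ (¬SMove-σ k e' ns)

    ¬DTurn-σ : ∀ k {s t} → t ≗ (s ∘σ) → ¬ DTurn k s → ¬ DTurn k t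
    ¬DTurn-σ k {s} {t} e ns d = ns (DTurn-ext k (∘σ-∘σ s) (DTurn-σ k (DTurn-ext k e d)))

    NotSTurn-σ : ∀ k {s t} → t ≗ (s ∘σ) → NotSTurn k s → NotSTurn k t
    NotSTurn-σ k {s} {t} e (y , fy , r) = σ y , trans (e (σ y)) (trans (cong s (inv y)) fy) , r' r
      where
      e' : (t [ σ y ≔ stal ]) ≗ ((s [ y ≔ stal ]) ∘σ)
      e' u = trans (upd-ext e (σ y) stal u) (upd-σ-∘σ s y stal u)
      r' : StalWin (s [ y ≔ stal ]) ⊎ ¬ DTurn k (s [ y ≔ stal ]) → StalWin (t [ σ y ≔ stal ]) ⊎ ¬ DTurn k (t [ σ y ≔ stal ])
      r' (inj₁ sw) = inj₁ (StalWin-ext (≗-sym e') (StalWin-σ sw))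
      r' (inj₂ ns) = inj₂ (¬DTurn-σ k e' ns)

module DecidableGame (G : Graph)
          (nb? : ∀ v u → Dec (G ∈N[ v ] u))
          (exV : ∀ {P : V G → Set} → (∀ v → Dec (P v)) → Dec (∃ P)) where
  open GameFacts G public

  Dominated : State → Vertex → Set
  Dominated s v = ∃ λ u → G ∈N[ v ] u × s u ≡ dom

  allV : ∀ {P : Vertex → Set} → (∀ v → Dec (P v)) → Dec (∀ v → P v)
  allV {P} d with exV (λ v → ¬? (d v))
  ... | yes (v , nv) = no (λ f → nv (f v))
  ... | no h = yes (λ v → dd v (d v))
    where dd : ∀ v → Dec (P v) → P v
          dd v (yes p) = p
          dd v (no np) = ⊥-elim (h (v , np))

  Dominated? : ∀ s v → Dec (Dominated s v)
  Dominated? s v = exV (λ u → nb? v u ×-dec owner-≟ (s u) dom)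

  DomWin? : ∀ s → Dec (DomWin s)
  DomWin? s = allV (Dominated? s)

  free≢dom : free ≢ dom
  free≢dom ()
  free≢stal : free ≢ stal
  free≢stal ()
  dom≢stal : dom ≢ stal
  dom≢stal ()

  free-≢-owned : ∀ {s : State} {a b} {o} → s a ≡ free → s b ≡ o → o ≢ free → a ≢ b
  free-≢-owned {s} fa ob ne refl = ne (trans (sym ob) fa)

  -- Pairing strategies

  Pairs : ℕ → Set
  Pairs m = Fin m → Vertex × Vertex

  _∈P_ : Vertex → (Vertex × Vertex) → Set
  u ∈P ab = u ≡ proj₁ ab ⊎ u ≡ proj₂ ab

  ∈P? : ∀ u ab → Dec (u ∈P ab)
  ∈P? u (a , b) with u ≟V a | u ≟V b
  ... | yes e | _ = yes (inj₁ e)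
  ... | no _ | yes e = yes (inj₂ e)
  ... | no n1 | no n2 = no (λ { (inj₁ e) → n1 e ; (inj₂ e) → n2 e })

  record IsPairing {m} (s : State) (p : Pairs m) : Set where
    field
      proper : ∀ i → proj₁ (p i) ≢ proj₂ (p i)
      disj : ∀ i j u → u ∈P p i → u ∈P p j → i ≡ j
      free₁ : ∀ i → s (proj₁ (p i)) ≡ free
      free₂ : ∀ i → s (proj₂ (p i)) ≡ free

  PairIn : ∀ {m} → Pairs m → Vertex → Set
  PairIn p v = ∃ λ i → G ∈N[ v ] (proj₁ (p i)) × G ∈N[ v ] (proj₂ (p i))

  pair-free : ∀ {m} {s} {p : Pairs m} → IsPairing s p → ∀ i u → u ∈P p i → s u ≡ free
  pair-free ok i u (inj₁ refl) = IsPairing.free₁ ok i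
  pair-free ok i u (inj₂ refl) = IsPairing.free₂ ok i

  upd-keeps : ∀ (s : State) {w} o {u} {o'} → s w ≡ free → s u ≡ o' → o' ≢ free → (s [ w ≔ o ]) u ≡ o'
  upd-keeps s o {u} fw su ne = trans (upd-neq s o (λ e → free-≢-owned {s} fw su ne (sym e))) su

  dom≢free : dom ≢ free
  dom≢free ()
  stal≢free : stal ≢ free
  stal≢free ()

  IsPairing-upd : ∀ {m} {s} {p : Pairs m} → IsPairing s p → ∀ y o → (∀ i → ¬ y ∈P p i) → IsPairing (s [ y ≔ o ]) p
  IsPairing-upd {s = s} ok y o ny = record { proper = IsPairing.proper ok ; disj = IsPairing.disj ok
    ; free₁ = λ i → trans (upd-neq s o (λ e → ny i (inj₁ (sym e)))) (IsPairing.free₁ ok i)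
    ; free₂ = λ i → trans (upd-neq s o (λ e → ny i (inj₂ (sym e)))) (IsPairing.free₂ ok i) }

  IsPairing-empty : ∀ {m} {s} {p : Pairs m} → m ≡ zero → IsPairing s p
  IsPairing-empty refl = record { proper = λ () ; disj = λ () ; free₁ = λ () ; free₂ = λ () }

  IsPairing-remove : ∀ {m} {s} {p : Pairs (suc m)} (ok : IsPairing s p) (i : Fin (suc m)) {w} o →
             (∀ j → j ≢ i → ¬ w ∈P p j) → IsPairing (s [ w ≔ o ]) (λ j → p (punchIn i j))
  IsPairing-remove {s = s} {p} ok i {w} o nw = record
    { proper = λ j → IsPairing.proper ok (punchIn i j)
    ; disj = λ j j' u h h' → punchIn-injective i j j' (IsPairing.disj ok _ _ u h h')
    ; free₁ = λ j → trans (upd-neq s o (λ e → nw (punchIn i j) (punchInᵢ≢i i j) (inj₁ (sym e)))) (IsPairing.free₁ ok (punchIn i j))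
    ; free₂ = λ j → trans (upd-neq s o (λ e → nw (punchIn i j) (punchInᵢ≢i i j) (inj₂ (sym e)))) (IsPairing.free₂ ok (punchIn i j))
    }

  PairIn-remove : ∀ {m} {p : Pairs (suc m)} i x → x ∈P p i → ∀ v → PairIn p v →
                  G ∈N[ v ] x ⊎ PairIn (λ j → p (punchIn i j)) v
  PairIn-remove {p = p} i x xi v (j , h1 , h2) with j ≟F i
  ... | yes e = inj₁ (case (subst (λ z → x ∈P p z) (sym e) xi))
    where case : x ∈P p j → G ∈N[ v ] x
          case (inj₁ q) = subst (λ z → G ∈N[ v ] z) (sym q) h1
          case (inj₂ q) = subst (λ z → G ∈N[ v ] z) (sym q) h2
  ... | no ne = inj₂ (punchOut ne' , subst (λ z → G ∈N[ v ] (proj₁ (p z)) × G ∈N[ v ] (proj₂ (p z)))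
                                         (sym (punchIn-punchOut ne')) (h1 , h2))
    where ne' : i ≢ j
          ne' e = ne (sym e)

  claimed-by-stal : ∀ (s : State) w a → (s [ w ≔ stal ]) a ≡ stal → s a ≡ free → a ≡ w
  claimed-by-stal s w a e fa with upd-cases s w stal a
  ... | inj₁ (q , _) = q
  ... | inj₂ (q , r) = ⊥-elim (free≢stal (trans (sym fa) (trans (sym r) e)))

  pairing-¬StalWin : ∀ {m} {s} {p : Pairs m} → IsPairing s p → (∀ v → Dominated s v ⊎ PairIn p v) →
              ∀ w → s w ≡ free → ¬ StalWin (s [ w ≔ stal ])
  pairing-¬StalWin {s = s} {p} ok cov w fw (v , f) with cov v
  ... | inj₁ (u , h , d) = dom≢stal (trans (sym (upd-keeps s stal fw d dom≢free)) (f u h))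
  ... | inj₂ (i , h1 , h2) = IsPairing.proper ok i (trans (claimed-by-stal s w _ (f _ h1) (IsPairing.free₁ ok i)) (sym (claimed-by-stal s w _ (f _ h2) (IsPairing.free₂ ok i))))

  mutual
    pairing-DTurn : ∀ m s x (p : Pairs m) → s x ≡ free → (∀ i → ¬ x ∈P p i) → IsPairing s p →
         (∀ v → Dominated s v ⊎ G ∈N[ v ] x ⊎ PairIn p v) → DTurn (suc m) s
    pairing-DTurn zero s x p fx nx ok cov = x , fx , inj₁ dw
      where dw : DomWin (s [ x ≔ dom ])
            dw v with cov v
            ... | inj₁ (u , h , d) = u , h , upd-keeps s dom fx d dom≢free
            ... | inj₂ (inj₁ h) = x , h , upd-eq s x dom
            ... | inj₂ (inj₂ (() , _))
    pairing-DTurn (suc m) s x p fx nx ok cov = x , fx , inj₂ (pairing-STurn m (s [ x ≔ dom ]) p (IsPairing-upd ok x dom nx) cov')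
      where cov' : ∀ v → Dominated (s [ x ≔ dom ]) v ⊎ PairIn p v
            cov' v with cov v
            ... | inj₁ (u , h , d) = inj₁ (u , h , upd-keeps s dom fx d dom≢free)
            ... | inj₂ (inj₁ h) = inj₁ (x , h , upd-eq s x dom)
            ... | inj₂ (inj₂ q) = inj₂ q

    pairing-STurn : ∀ m s (p : Pairs (suc m)) → IsPairing s p → (∀ v → Dominated s v ⊎ PairIn p v) → STurn (suc m) s
    pairing-STurn m s p ok cov w fw = pairing-¬StalWin ok cov w fw , dt
      where
      s' = s [ w ≔ stal ]
      rem : (i : Fin (suc m)) (x : Vertex) → x ∈P p i → x ≢ w → (∀ j → j ≢ i → ¬ w ∈P p j) → DTurn (suc m) s'
      rem i x xi xw nw = pairing-DTurn m s' x (λ j → p (punchIn i j))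
             (trans (upd-neq s stal xw) (pair-free ok i x xi))
             (λ j h → punchInᵢ≢i i j (IsPairing.disj ok _ _ x h xi))
             (IsPairing-remove ok i stal nw)
             cov'
        where cov' : ∀ v → Dominated s' v ⊎ G ∈N[ v ] x ⊎ PairIn (λ j → p (punchIn i j)) v
              cov' v with cov v
              ... | inj₁ (u , h , d) = inj₁ (u , h , upd-keeps s stal fw d dom≢free)
              ... | inj₂ q = inj₂ (PairIn-remove i x xi v q)
      dt : DTurn (suc m) s'
      dt with any? (λ i → ∈P? w (p i))
      ... | yes (i , inj₁ e) = rem i (proj₂ (p i)) (inj₂ refl) (λ q → IsPairing.proper ok i (trans (sym e) (sym q)))
                                   (λ j ne h → ne (IsPairing.disj ok j i w h (inj₁ e)))
      ... | yes (i , inj₂ e) = rem i (proj₁ (p i)) (inj₁ refl) (λ q → IsPairing.proper ok i (trans q e))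
                                   (λ j ne h → ne (IsPairing.disj ok j i w h (inj₂ e)))
      ... | no nw = rem fz (proj₁ (p fz)) (inj₁ refl) (λ q → nw (fz , inj₁ (sym q))) (λ j _ h → nw (j , h))

  undominated : ∀ s → ¬ DomWin s → ∃ λ v → ¬ Dominated s v
  undominated s nd with exV (λ v → ¬? (Dominated? s v))
  ... | yes r = r
  ... | no h = ⊥-elim (nd (λ v → dd v (Dominated? s v)))
    where dd : ∀ v → Dec (Dominated s v) → Dominated s v
          dd v (yes p) = p
          dd v (no np) = ⊥-elim (h (v , np))

  non-stal-neighbour : ∀ s v → ¬ StalWin s → ∃ λ u → G ∈N[ v ] u × s u ≢ stal
  non-stal-neighbour s v ns with exV (λ u → nb? v u ×-dec ¬? (owner-≟ (s u) stal))
  ... | yes (u , h , ne) = u , h , ne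
  ... | no h = ⊥-elim (ns (v , λ u hu → dd u hu (owner-≟ (s u) stal)))
    where dd : ∀ u → G ∈N[ v ] u → Dec (s u ≡ stal) → s u ≡ stal
          dd u hu (yes p) = p
          dd u hu (no np) = ⊥-elim (h (u , hu , np))

  owner-free : ∀ (o : Owner) → o ≢ dom → o ≢ stal → o ≡ free
  owner-free free _ _ = refl
  owner-free dom a _ = ⊥-elim (a refl)
  owner-free stal _ b = ⊥-elim (b refl)

  pred-of : ∀ {m} → Fin m → ℕ
  pred-of {suc m} _ = m

  dropPair : ∀ {m} (p : Pairs m) (i : Fin m) → Pairs (pred-of i)
  dropPair {suc m} p i j = p (punchIn i j)

  IsPairing-drop : ∀ {m} {s} {p : Pairs m} (ok : IsPairing s p) (i : Fin m) {w} o →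
              (∀ j → j ≢ i → ¬ w ∈P p j) → IsPairing (s [ w ≔ o ]) (dropPair p i)
  IsPairing-drop {suc m} ok i o nw = IsPairing-remove ok i o nw

  PairIn-drop : ∀ {m} {p : Pairs m} i x → x ∈P p i → ∀ v → PairIn p v →
                   G ∈N[ v ] x ⊎ PairIn (dropPair p i) v
  PairIn-drop {suc m} i x xi v q = PairIn-remove i x xi v q

  dropPair-∌ : ∀ {m} {s} {p : Pairs m} → IsPairing s p → ∀ i x → x ∈P p i → ∀ j → ¬ x ∈P dropPair p i j
  dropPair-∌ {suc m} ok i x xi j h = punchInᵢ≢i i j (IsPairing.disj ok _ _ x h xi)

  Fin-or-zero : ∀ m → Fin m ⊎ m ≡ zero
  Fin-or-zero zero = inj₂ refl
  Fin-or-zero (suc m) = inj₁ fz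

  Fin0-empty : ∀ {m} → m ≡ zero → Fin m → ⊥
  Fin0-empty refl ()

  -- A neighbourhood with k + 1 free vertices cannot be completed by Staller in k moves.
  FreeCount : State → Vertex → ℕ → Set
  FreeCount s v k = Σ (Fin (suc k) → Vertex) λ f → (∀ i j → f i ≡ f j → i ≡ j) × (∀ i → G ∈N[ v ] (f i) × s (f i) ≡ free)

  Covered : ℕ → State → ∀ {m} → Pairs m → Set
  Covered k s p = ∀ v → Dominated s v ⊎ PairIn p v ⊎ FreeCount s v k

  -- Dominator answers in the pair Staller touched; a free count Staller hits keeps k + 1 of its
  -- k + 2 vertices.
  pairing-¬SMove : ∀ k m s (p : Pairs m) → IsPairing s p → Covered k s p → ¬ DomWin s → ¬ SMove k s
  pairing-¬SMove zero m s p ok cov nd ()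
  pairing-¬SMove (suc k) m s p ok cov nd = ¬SMove-suc step
    where
    step : ∀ w → s w ≡ free → ¬ StalWin (s [ w ≔ stal ]) × NotDReply k (s [ w ≔ stal ])
    step w fw = nsw , ndr
      where
      s' = s [ w ≔ stal ]
      nsw : ¬ StalWin s'
      nsw (v , f) with cov v
      ... | inj₁ (u , h , d) = dom≢stal (trans (sym (upd-keeps s stal fw d dom≢free)) (f u h))
      ... | inj₂ (inj₁ (i , h1 , h2)) = IsPairing.proper ok i (trans (claimed-by-stal s w _ (f _ h1) (IsPairing.free₁ ok i)) (sym (claimed-by-stal s w _ (f _ h2) (IsPairing.free₂ ok i))))
      ... | inj₂ (inj₂ (g , inj , fr)) with inj fz (fs fz) (trans (claimed-by-stal s w _ (f _ (proj₁ (fr fz))) (proj₂ (fr fz))) (sym (claimed-by-stal s w _ (f _ (proj₁ (fr (fs fz)))) (proj₂ (fr (fs fz))))))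
      ... | ()
      after : (y : Vertex) (m' : ℕ) (p' : Pairs m') → s' y ≡ free → IsPairing (s' [ y ≔ dom ]) p' →
              (∀ v → PairIn p v → G ∈N[ v ] y ⊎ PairIn p' v) → NotDReply k s'
      after y m' p' fy ok' tr with DomWin? (s' [ y ≔ dom ])
      ... | yes dw = y , fy , inj₁ dw
      ... | no ndw = y , fy , inj₂ (pairing-¬SMove k m' (s' [ y ≔ dom ]) p' ok' cov' ndw)
        where
        s'' = s' [ y ≔ dom ]
        ydom : ∀ v → G ∈N[ v ] y → Dominated s'' v
        ydom v h = y , h , upd-eq s' y dom
        cov' : Covered k s'' p'
        cov' v with cov v
        ... | inj₁ (u , h , d) = inj₁ (u , h , upd-keeps s' dom fy (upd-keeps s stal fw d dom≢free) dom≢free)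
        ... | inj₂ (inj₁ q) with tr v q
        ...   | inj₁ h = inj₁ (ydom v h)
        ...   | inj₂ q' = inj₂ (inj₁ q')
        cov' v | inj₂ (inj₂ (g , inj , fr)) with any? (λ j → g j ≟V y)
        ...   | yes (j , e) = inj₁ (ydom v (subst (λ z → G ∈N[ v ] z) e (proj₁ (fr j))))
        ...   | no ny = inj₂ (inj₂ (cnt (any? (λ j → g j ≟V w))))
          where
          mk : (j : Fin (suc (suc k))) → (∀ i → g (punchIn j i) ≢ w) → FreeCount s'' v k
          mk j nw = (λ i → g (punchIn j i)) ,
                    (λ i i' e → punchIn-injective j i i' (inj _ _ e)) ,
                    (λ i → proj₁ (fr (punchIn j i)) ,
                           trans (upd-neq s' dom (λ e → ny (punchIn j i , e)))
                                 (trans (upd-neq s stal (nw i)) (proj₂ (fr (punchIn j i)))))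
          cnt : Dec (∃ λ j → g j ≡ w) → FreeCount s'' v k
          cnt (yes (j , e)) = mk j (λ i e' → punchInᵢ≢i j i (inj _ _ (trans e' (sym e))))
          cnt (no nw) = mk fz (λ i e' → nw (punchIn fz i , e'))
      fin-y : ∀ {y : Vertex} {i} → y ∈P p i → y ≢ w → s' y ≡ free
      fin-y {y} {i} yi yw = trans (upd-neq s stal yw) (pair-free ok i y yi)
      remi : (i : Fin m) (y : Vertex) → y ∈P p i → y ≢ w → (∀ j → j ≢ i → ¬ w ∈P p j) → NotDReply k s'
      remi i y yi yw nw = after y (pred-of i) (dropPair p i) (fin-y yi yw)
                            (IsPairing-upd (IsPairing-drop ok i stal nw) y dom (dropPair-∌ ok i y yi))
                            (λ v q → PairIn-drop i y yi v q)
      ndr : NotDReply k s'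
      ndr with any? (λ i → ∈P? w (p i))
      ... | yes (i , inj₁ e) = remi i (proj₂ (p i)) (inj₂ refl) (λ q → IsPairing.proper ok i (trans (sym e) (sym q)))
                                   (λ j ne h → ne (IsPairing.disj ok j i w h (inj₁ e)))
      ... | yes (i , inj₂ e) = remi i (proj₁ (p i)) (inj₁ refl) (λ q → IsPairing.proper ok i (trans q e))
                                   (λ j ne h → ne (IsPairing.disj ok j i w h (inj₂ e)))
      ... | no nw with Fin-or-zero m
      ...   | inj₁ i0 = remi i0 (proj₁ (p i0)) (inj₁ refl) (λ q → nw (i0 , inj₁ (sym q))) (λ j _ h → nw (j , h))
      ...   | inj₂ m0 with undominated s nd
      ...     | v0 , nv0 with non-stal-neighbour s' v0 nsw
      ...       | u , hu , ns = after u m p fu (IsPairing-empty m0) (λ v q → ⊥-elim (Fin0-empty m0 (proj₁ q)))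
        where
        uw : u ≢ w
        uw e = ns (trans (cong s' e) (upd-eq s w stal))
        fu : s' u ≡ free
        fu = trans (upd-neq s stal uw) (owner-free (s u) (λ d → nv0 (u , hu , d)) (λ st → ns (trans (upd-neq s stal uw) st)))

  upd-free : ∀ (s : State) x o u → o ≢ free → (s [ x ≔ o ]) u ≡ free → (u ≢ x) × s u ≡ free
  upd-free s x o u ne e with upd-cases s x o u
  ... | inj₁ (_ , q) = ⊥-elim (ne (trans (sym q) e))
  ... | inj₂ (q , r) = q , trans (sym r) e

  upd-ndom : ∀ (s : State) x o u → o ≢ dom → s u ≢ dom → (s [ x ≔ o ]) u ≢ dom
  upd-ndom s x o u ne nd e with upd-cases s x o u
  ... | inj₁ (_ , q) = ne (trans (sym q) e)
  ... | inj₂ (_ , r) = nd (trans (sym r) e)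

  stal≢dom : stal ≢ dom
  stal≢dom ()

  owner-stal : ∀ (o : Owner) → o ≢ dom → o ≢ free → o ≡ stal
  owner-stal free _ b = ⊥-elim (b refl)
  owner-stal dom a _ = ⊥-elim (a refl)
  owner-stal stal _ _ = refl

  -- Disjoint undominated neighbourhoods

  UndominatedFamily : ∀ k → State → (Fin (suc k) → Vertex) → Set
  UndominatedFamily k s h = (∀ i u → G ∈N[ h i ] u → s u ≢ dom)
               × (∀ i j u → i ≢ j → G ∈N[ h i ] u → G ∈N[ h j ] u → s u ≢ free)
               × (∀ i → ∃ λ u → G ∈N[ h i ] u × s u ≡ free)

  -- Dominator's move meets the free part of at most one member; Staller claims a free vertex
  -- of another member, which she thereby completes or which survives in a smaller family.
  family-¬DTurn : ∀ k s (h : Fin (suc k) → Vertex) → UndominatedFamily k s h → ¬ DTurn k s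
  family-¬DTurn zero s h fam ()
  family-¬DTurn (suc k) s h (nodom , disj , hasfree) = ¬DTurn-suc step
    where
    step : ∀ v → s v ≡ free → ¬ DomWin (s [ v ≔ dom ]) × NotSTurn k (s [ v ≔ dom ])
    step v fv = main (any? (λ i → nb? (h i) v))
      where
      s' = s [ v ≔ dom ]
      main : Dec (∃ λ i → G ∈N[ h i ] v) → ¬ DomWin s' × NotSTurn k s'
      main d = nodw , w , fw' , res
        where
        r : Fin (suc (suc k))
        r = pick d
          where pick : Dec (∃ λ i → G ∈N[ h i ] v) → Fin (suc (suc k))
                pick (yes (i , _)) = i
                pick (no _) = fz
        notin : ∀ i → i ≢ r → ¬ G ∈N[ h i ] v
        notin i ne hv = aux d refl
          where aux : (d' : Dec (∃ λ i → G ∈N[ h i ] v)) → d' ≡ d → ⊥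
                aux (yes (i' , hi')) refl = disj i i' v ne hv hi' fv
                aux (no nh) refl = nh (i , hv)
        j : Fin (suc (suc k))
        j = punchIn r fz
        jr : j ≢ r
        jr = punchInᵢ≢i r fz
        nodw : ¬ DomWin s'
        nodw dw with dw (h j)
        ... | u , hu , du with upd-cases s v dom u
        ...   | inj₁ (e , _) = notin j jr (subst (λ z → G ∈N[ h j ] z) e hu)
        ...   | inj₂ (_ , q) = nodom j u hu (trans (sym q) du)
        w = proj₁ (hasfree j)
        hw = proj₁ (proj₂ (hasfree j))
        fw = proj₂ (proj₂ (hasfree j))
        wv : w ≢ v
        wv e = notin j jr (subst (λ z → G ∈N[ h j ] z) e hw)
        fw' : s' w ≡ free
        fw' = trans (upd-neq s dom wv) fw
        s'' = s' [ w ≔ stal ]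
        base : ∀ u → s'' u ≡ free → s u ≡ free
        base u e = proj₂ (upd-free s v dom u dom≢free (proj₂ (upd-free s' w stal u stal≢free e)))
        nd-i : ∀ i → i ≢ r → ∀ u → G ∈N[ h i ] u → s'' u ≢ dom
        nd-i i ne u hu = upd-ndom s' w stal u stal≢dom
                           (λ e → nodom i u hu (trans (sym (upd-neq s dom uv)) e))
          where uv : u ≢ v
                uv e = notin i ne (subst (λ z → G ∈N[ h i ] z) e hu)
        res : StalWin s'' ⊎ ¬ DTurn k s''
        res with exV (λ u → nb? (h j) u ×-dec owner-≟ (s'' u) free)
        ... | no nf = inj₁ (h j , λ u hu → owner-stal (s'' u) (nd-i j jr u hu) (λ e → nf (u , hu , e)))
        ... | yes (u1 , hu1 , fu1) = inj₂ (family-¬DTurn k s'' (λ i → h (punchIn r i)) (nodom' , disj' , hasfree'))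
          where
          nodom' : ∀ i u → G ∈N[ h (punchIn r i) ] u → s'' u ≢ dom
          nodom' i u hu = nd-i (punchIn r i) (punchInᵢ≢i r i) u hu
          disj' : ∀ i i' u → i ≢ i' → G ∈N[ h (punchIn r i) ] u → G ∈N[ h (punchIn r i') ] u → s'' u ≢ free
          disj' i i' u ne h1 h2 e = disj _ _ u (λ q → ne (punchIn-injective r i i' q)) h1 h2 (base u e)
          hasfree' : ∀ i → ∃ λ u → G ∈N[ h (punchIn r i) ] u × s'' u ≡ free
          hasfree' i with punchIn r i ≟F j
          ... | yes e = u1 , subst (λ z → G ∈N[ h z ] u1) (sym e) hu1 , fu1
          ... | no ne with hasfree (punchIn r i)
          ...   | u0 , h0 , f0 = u0 , h0 , trans (upd-neq s' stal u0w) (trans (upd-neq s dom u0v) f0)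
            where u0v : u0 ≢ v
                  u0v e = notin (punchIn r i) (punchInᵢ≢i r i) (subst (λ z → G ∈N[ h (punchIn r i) ] z) e h0)
                  u0w : u0 ≢ w
                  u0w e = disj (punchIn r i) j u0 ne h0 (subst (λ z → G ∈N[ h j ] z) (sym e) hw) f0

  -- Threats

  Threat : State → Vertex → Vertex → Set
  Threat s t x = s x ≡ free × (∀ u → G ∈N[ t ] u → u ≡ x ⊎ s u ≡ stal)

  threat-undom : ∀ {s t x} → Threat s t x → ∀ v → s v ≡ free → v ≢ x → ¬ Dominated (s [ v ≔ dom ]) t
  threat-undom {s} (fx , th) v fv vx (u , hu , du) with th u hu | upd-cases s v dom u
  ... | _ | inj₁ (e , _) with th v (subst (λ z → G ∈N[ _ ] z) e hu)
  ...   | inj₁ q = vx q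
  ...   | inj₂ q = free≢stal (trans (sym fv) q)
  threat-undom {s} (fx , th) v fv vx (u , hu , du) | inj₁ q | inj₂ (ne , r) = free≢dom (trans (sym fx) (trans (cong s (sym q)) (trans (sym r) du)))
  threat-undom {s} (fx , th) v fv vx (u , hu , du) | inj₂ q | inj₂ (ne , r) = stal≢dom (trans (sym q) (trans (sym r) du))

  threat-win : ∀ {s t x} → Threat s t x → ∀ v → s v ≡ free → v ≢ x → StalWin ((s [ v ≔ dom ]) [ x ≔ stal ])
  threat-win {s} {t} {x} (fx , th) v fv vx = t , f
    where f : ∀ u → G ∈N[ t ] u → ((s [ v ≔ dom ]) [ x ≔ stal ]) u ≡ stal
          f u hu with upd-cases (s [ v ≔ dom ]) x stal u
          ... | inj₁ (_ , q) = q
          ... | inj₂ (ne , q) with th u hu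
          ...   | inj₁ e = ⊥-elim (ne e)
          ...   | inj₂ st = trans q (trans (upd-neq s dom (λ e → free≢stal (trans (sym fv) (trans (cong s (sym e)) st)))) st)

  threat-after : ∀ {s t x} k → Threat s t x → ∀ v → s v ≡ free → v ≢ x →
                 ¬ DomWin (s [ v ≔ dom ]) × NotSTurn k (s [ v ≔ dom ])
  threat-after {s} {t} {x} k th v fv vx =
    (λ dw → threat-undom th v fv vx (dw t)) ,
    x , trans (upd-neq s dom (λ e → vx (sym e))) (proj₁ th) , inj₁ (threat-win th v fv vx)

  threat-¬DTurn : ∀ k {s t x} → Threat s t x → (¬ DomWin (s [ x ≔ dom ]) × NotSTurn k (s [ x ≔ dom ])) → ¬ DTurn (suc k) s
  threat-¬DTurn k {s} {t} {x} th cont = ¬DTurn-suc step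
    where step : ∀ v → s v ≡ free → ¬ DomWin (s [ v ≔ dom ]) × NotSTurn k (s [ v ≔ dom ])
          step v fv with v ≟V x
          ... | yes e = subst (λ z → ¬ DomWin (s [ z ≔ dom ]) × NotSTurn k (s [ z ≔ dom ])) (sym e) cont
          ... | no ne = threat-after k th v fv ne

  double-threat-¬DTurn : ∀ k {s t1 x1 t2 x2} → Threat s t1 x1 → Threat s t2 x2 → x1 ≢ x2 → ¬ DTurn k s
  double-threat-¬DTurn zero th1 th2 ne ()
  double-threat-¬DTurn (suc k) {s} {t1} {x1} {t2} {x2} th1 th2 ne = ¬DTurn-suc step
    where step : ∀ v → s v ≡ free → ¬ DomWin (s [ v ≔ dom ]) × NotSTurn k (s [ v ≔ dom ])
          step v fv with v ≟V x1
          ... | yes e = threat-after k th2 v fv (λ e' → ne (trans (sym e) e'))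
          ... | no n1 = threat-after k th1 v fv n1

  threat-afterS : ∀ {s t x} k → Threat s t x → ∀ v → s v ≡ free → v ≢ x →
                  ¬ DomWin (s [ v ≔ dom ]) × SMove (suc k) (s [ v ≔ dom ])
  threat-afterS {s} {t} {x} k th v fv vx =
    (λ dw → threat-undom th v fv vx (dw t)) ,
    x , trans (upd-neq s dom (λ e → vx (sym e))) (proj₁ th) , inj₁ (threat-win th v fv vx)

  threat-DReply : ∀ k {s t x} → Threat s t x → (¬ DomWin (s [ x ≔ dom ]) × SMove (suc k) (s [ x ≔ dom ])) → DReply (suc k) s
  threat-DReply k {s} {t} {x} th cont v fv with v ≟V x
  ... | yes e = subst (λ z → ¬ DomWin (s [ z ≔ dom ]) × SMove (suc k) (s [ z ≔ dom ])) (sym e) cont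
  ... | no ne = threat-afterS k th v fv ne

  double-threat-DReply : ∀ k {s t1 x1 t2 x2} → Threat s t1 x1 → Threat s t2 x2 → x1 ≢ x2 → DReply (suc k) s
  double-threat-DReply k {s} {t1} {x1} {t2} {x2} th1 th2 ne v fv with v ≟V x1
  ... | yes e = threat-afterS k th2 v fv (λ e' → ne (trans (sym e) e'))
  ... | no n1 = threat-afterS k th1 v fv n1

module Board (n : ℕ) where
  G : Graph
  G = P₃ □ K₁ n

  nb? : ∀ (v u : V G) → Dec (G ∈N[ v ] u)
  nb? (a , b) (c , d) =
    _≟_ G (c , d) (a , b) ⊎-dec
      ((a ≟F c ×-dec ((b ≟F fz ×-dec ¬? (d ≟F fz)) ⊎-dec (d ≟F fz ×-dec ¬? (b ≟F fz))))
       ⊎-dec (b ≟F d ×-dec ((suc (toℕ a) ≟ℕ toℕ c) ⊎-dec (suc (toℕ c) ≟ℕ toℕ a))))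

  exV : ∀ {P : V G → Set} → (∀ v → Dec (P v)) → Dec (∃ P)
  exV {P} d with any? (λ i → any? (λ j → d (i , j)))
  ... | yes (i , j , p) = yes ((i , j) , p)
  ... | no h = no (λ { ((i , j) , p) → h (i , j , p) })

  open DecidableGame G nb? exV public

  L0 L1 L2 : Fin 3
  L0 = fz
  L1 = fs fz
  L2 = fs (fs fz)

  cA cB cC : Vertex
  cA = (L0 , fz)
  cB = (L1 , fz)
  cC = (L2 , fz)

  la lb ld : Fin n → Vertex
  la j = (L0 , fs j)
  lb j = (L1 , fs j)
  ld j = (L2 , fs j)

  n-self : ∀ v → G ∈N[ v ] v
  n-self v = inj₁ refl

  n-lc : ∀ i j → G ∈N[ (i , fs j) ] (i , fz)
  n-lc i j = inj₂ (inj₁ (refl , inj₂ (refl , λ ())))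

  n-cl : ∀ i j → G ∈N[ (i , fz) ] (i , fs j)
  n-cl i j = inj₂ (inj₁ (refl , inj₁ (refl , λ ())))

  n-01 : ∀ c → G ∈N[ (L0 , c) ] (L1 , c)
  n-01 c = inj₂ (inj₂ (refl , inj₁ refl))
  n-10 : ∀ c → G ∈N[ (L1 , c) ] (L0 , c)
  n-10 c = inj₂ (inj₂ (refl , inj₂ refl))
  n-12 : ∀ c → G ∈N[ (L1 , c) ] (L2 , c)
  n-12 c = inj₂ (inj₂ (refl , inj₁ refl))
  n-21 : ∀ c → G ∈N[ (L2 , c) ] (L1 , c)
  n-21 c = inj₂ (inj₂ (refl , inj₂ refl))

  N[la]-cases : ∀ j u → G ∈N[ la j ] u → u ≡ la j ⊎ u ≡ cA ⊎ u ≡ lb j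
  N[la]-cases j u (inj₁ e) = inj₁ e
  N[la]-cases j (.L0 , d) (inj₂ (inj₁ (refl , inj₁ (() , _))))
  N[la]-cases j (.L0 , .fz) (inj₂ (inj₁ (refl , inj₂ (refl , _)))) = inj₂ (inj₁ refl)
  N[la]-cases j (fs fz , .(fs j)) (inj₂ (inj₂ (refl , _))) = inj₂ (inj₂ refl)
  N[la]-cases j (fz , .(fs j)) (inj₂ (inj₂ (refl , inj₁ ())))
  N[la]-cases j (fz , .(fs j)) (inj₂ (inj₂ (refl , inj₂ ())))
  N[la]-cases j (fs (fs fz) , .(fs j)) (inj₂ (inj₂ (refl , inj₁ ())))
  N[la]-cases j (fs (fs fz) , .(fs j)) (inj₂ (inj₂ (refl , inj₂ ())))

  N[ld]-cases : ∀ j u → G ∈N[ ld j ] u → u ≡ ld j ⊎ u ≡ cC ⊎ u ≡ lb j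
  N[ld]-cases j u (inj₁ e) = inj₁ e
  N[ld]-cases j (.L2 , d) (inj₂ (inj₁ (refl , inj₁ (() , _))))
  N[ld]-cases j (.L2 , .fz) (inj₂ (inj₁ (refl , inj₂ (refl , _)))) = inj₂ (inj₁ refl)
  N[ld]-cases j (fs fz , .(fs j)) (inj₂ (inj₂ (refl , _))) = inj₂ (inj₂ refl)
  N[ld]-cases j (fz , .(fs j)) (inj₂ (inj₂ (refl , inj₁ ())))
  N[ld]-cases j (fz , .(fs j)) (inj₂ (inj₂ (refl , inj₂ ())))
  N[ld]-cases j (fs (fs fz) , .(fs j)) (inj₂ (inj₂ (refl , inj₁ ())))
  N[ld]-cases j (fs (fs fz) , .(fs j)) (inj₂ (inj₂ (refl , inj₂ ())))

  N[lb]-cases : ∀ j u → G ∈N[ lb j ] u → u ≡ lb j ⊎ u ≡ cB ⊎ u ≡ la j ⊎ u ≡ ld j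
  N[lb]-cases j u (inj₁ e) = inj₁ e
  N[lb]-cases j (.L1 , d) (inj₂ (inj₁ (refl , inj₁ (() , _))))
  N[lb]-cases j (.L1 , .fz) (inj₂ (inj₁ (refl , inj₂ (refl , _)))) = inj₂ (inj₁ refl)
  N[lb]-cases j (fz , .(fs j)) (inj₂ (inj₂ (refl , _))) = inj₂ (inj₂ (inj₁ refl))
  N[lb]-cases j (fs (fs fz) , .(fs j)) (inj₂ (inj₂ (refl , _))) = inj₂ (inj₂ (inj₂ refl))
  N[lb]-cases j (fs fz , .(fs j)) (inj₂ (inj₂ (refl , inj₁ ())))
  N[lb]-cases j (fs fz , .(fs j)) (inj₂ (inj₂ (refl , inj₂ ())))

  N[A]-cases : ∀ u → G ∈N[ cA ] u → u ≡ cA ⊎ u ≡ cB ⊎ ∃ λ j → u ≡ la j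
  N[A]-cases u (inj₁ e) = inj₁ e
  N[A]-cases (.L0 , fs j) (inj₂ (inj₁ (refl , inj₁ (refl , _)))) = inj₂ (inj₂ (j , refl))
  N[A]-cases (.L0 , fz) (inj₂ (inj₁ (refl , inj₁ (refl , ne)))) = ⊥-elim (ne refl)
  N[A]-cases (.L0 , d) (inj₂ (inj₁ (refl , inj₂ (_ , ne)))) = ⊥-elim (ne refl)
  N[A]-cases (fs fz , .fz) (inj₂ (inj₂ (refl , _))) = inj₂ (inj₁ refl)
  N[A]-cases (fz , .fz) (inj₂ (inj₂ (refl , inj₁ ())))
  N[A]-cases (fz , .fz) (inj₂ (inj₂ (refl , inj₂ ())))
  N[A]-cases (fs (fs fz) , .fz) (inj₂ (inj₂ (refl , inj₁ ())))
  N[A]-cases (fs (fs fz) , .fz) (inj₂ (inj₂ (refl , inj₂ ())))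

  N[C]-cases : ∀ u → G ∈N[ cC ] u → u ≡ cC ⊎ u ≡ cB ⊎ ∃ λ j → u ≡ ld j
  N[C]-cases u (inj₁ e) = inj₁ e
  N[C]-cases (.L2 , fs j) (inj₂ (inj₁ (refl , inj₁ (refl , _)))) = inj₂ (inj₂ (j , refl))
  N[C]-cases (.L2 , fz) (inj₂ (inj₁ (refl , inj₁ (refl , ne)))) = ⊥-elim (ne refl)
  N[C]-cases (.L2 , d) (inj₂ (inj₁ (refl , inj₂ (_ , ne)))) = ⊥-elim (ne refl)
  N[C]-cases (fs fz , .fz) (inj₂ (inj₂ (refl , _))) = inj₂ (inj₁ refl)
  N[C]-cases (fz , .fz) (inj₂ (inj₂ (refl , inj₁ ())))
  N[C]-cases (fz , .fz) (inj₂ (inj₂ (refl , inj₂ ())))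
  N[C]-cases (fs (fs fz) , .fz) (inj₂ (inj₂ (refl , inj₁ ())))
  N[C]-cases (fs (fs fz) , .fz) (inj₂ (inj₂ (refl , inj₂ ())))

  N[B]-cases : ∀ u → G ∈N[ cB ] u → u ≡ cB ⊎ u ≡ cA ⊎ u ≡ cC ⊎ ∃ λ j → u ≡ lb j
  N[B]-cases u (inj₁ e) = inj₁ e
  N[B]-cases (.L1 , fs j) (inj₂ (inj₁ (refl , inj₁ (refl , _)))) = inj₂ (inj₂ (inj₂ (j , refl)))
  N[B]-cases (.L1 , fz) (inj₂ (inj₁ (refl , inj₁ (refl , ne)))) = ⊥-elim (ne refl)
  N[B]-cases (.L1 , d) (inj₂ (inj₁ (refl , inj₂ (_ , ne)))) = ⊥-elim (ne refl)
  N[B]-cases (fz , .fz) (inj₂ (inj₂ (refl , _))) = inj₂ (inj₁ refl)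
  N[B]-cases (fs (fs fz) , .fz) (inj₂ (inj₂ (refl , _))) = inj₂ (inj₂ (inj₁ refl))
  N[B]-cases (fs fz , .fz) (inj₂ (inj₂ (refl , inj₁ ())))
  N[B]-cases (fs fz , .fz) (inj₂ (inj₂ (refl , inj₂ ())))

  data VView : Vertex → Set where
    isA : VView cA
    isB : VView cB
    isC : VView cC
    isa : ∀ j → VView (la j)
    isb : ∀ j → VView (lb j)
    isd : ∀ j → VView (ld j)

  view : ∀ v → VView v
  view (fz , fz) = isA
  view (fs fz , fz) = isB
  view (fs (fs fz) , fz) = isC
  view (fz , fs j) = isa j
  view (fs fz , fs j) = isb j
  view (fs (fs fz) , fs j) = isd j

  swap-ends : Fin 3 → Fin 3
  swap-ends fz = fs (fs fz)
  swap-ends (fs fz) = fs fz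
  swap-ends (fs (fs fz)) = fz

  σ : Vertex → Vertex
  σ (i , j) = (swap-ends i , j)

  σinv : ∀ u → σ (σ u) ≡ u
  σinv (fz , j) = refl
  σinv (fs fz , j) = refl
  σinv (fs (fs fz) , j) = refl

  σpres : ∀ v u → G ∈N[ v ] u → G ∈N[ σ v ] (σ u)
  σpres v u (inj₁ e) = inj₁ (cong σ e)
  σpres (a , b) (c , d) (inj₂ (inj₁ (e , k))) = inj₂ (inj₁ (cong swap-ends e , k))
  σpres (fz , b) (fs fz , d) (inj₂ (inj₂ (e , _))) = inj₂ (inj₂ (e , inj₂ refl))
  σpres (fs fz , b) (fz , d) (inj₂ (inj₂ (e , _))) = inj₂ (inj₂ (e , inj₁ refl))
  σpres (fs fz , b) (fs (fs fz) , d) (inj₂ (inj₂ (e , _))) = inj₂ (inj₂ (e , inj₂ refl))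
  σpres (fs (fs fz) , b) (fs fz , d) (inj₂ (inj₂ (e , _))) = inj₂ (inj₂ (e , inj₁ refl))
  σpres (fz , b) (fz , d) (inj₂ (inj₂ (e , inj₁ ())))
  σpres (fz , b) (fz , d) (inj₂ (inj₂ (e , inj₂ ())))
  σpres (fz , b) (fs (fs fz) , d) (inj₂ (inj₂ (e , inj₁ ())))
  σpres (fz , b) (fs (fs fz) , d) (inj₂ (inj₂ (e , inj₂ ())))
  σpres (fs fz , b) (fs fz , d) (inj₂ (inj₂ (e , inj₁ ())))
  σpres (fs fz , b) (fs fz , d) (inj₂ (inj₂ (e , inj₂ ())))
  σpres (fs (fs fz) , b) (fz , d) (inj₂ (inj₂ (e , inj₁ ())))
  σpres (fs (fs fz) , b) (fz , d) (inj₂ (inj₂ (e , inj₂ ())))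
  σpres (fs (fs fz) , b) (fs (fs fz) , d) (inj₂ (inj₂ (e , inj₁ ())))
  σpres (fs (fs fz) , b) (fs (fs fz) , d) (inj₂ (inj₂ (e , inj₂ ())))

  open Automorphism σ σinv σpres public

  upd-stal : ∀ (s : State) x o u → (s [ x ≔ o ]) u ≡ stal → u ≡ x ⊎ s u ≡ stal
  upd-stal s x o u e with upd-cases s x o u
  ... | inj₁ (q , _) = inj₁ q
  ... | inj₂ (_ , q) = inj₂ (trans (sym q) e)

  upd-stal-dom : ∀ (s : State) x u → (s [ x ≔ dom ]) u ≡ stal → s u ≡ stal
  upd-stal-dom s x u e with upd-cases s x dom u
  ... | inj₁ (_ , q) = ⊥-elim (dom≢stal (trans (sym q) e))
  ... | inj₂ (_ , q) = trans (sym q) e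

  empty-nstal : ∀ u → empty u ≢ stal
  empty-nstal u ()

  empty-nd : ∀ u → empty u ≢ dom
  empty-nd u ()

  single-stal-¬dom : ∀ w u → (empty [ w ≔ stal ]) u ≢ dom
  single-stal-¬dom w u e with upd-cases empty w stal u
  ... | inj₁ (_ , q) = stal≢dom (trans (sym q) e)
  ... | inj₂ (_ , q) = free≢dom (trans (sym q) e)

  la-inj : ∀ {i j} → la i ≡ la j → i ≡ j
  la-inj refl = refl
  lb-inj : ∀ {i j} → lb i ≡ lb j → i ≡ j
  lb-inj refl = refl
  ld-inj : ∀ {i j} → ld i ≡ ld j → i ≡ j
  ld-inj refl = refl

  pigeonhole-3-2 : ∀ {a b c y w : Vertex} → a ≢ b → a ≢ c → b ≢ c →
        (a ≡ y ⊎ a ≡ w) → (b ≡ y ⊎ b ≡ w) → (c ≡ y ⊎ c ≡ w) → ⊥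
  pigeonhole-3-2 ab ac bc (inj₁ p) (inj₁ q) _ = ab (trans p (sym q))
  pigeonhole-3-2 ab ac bc (inj₂ p) (inj₂ q) _ = ab (trans p (sym q))
  pigeonhole-3-2 ab ac bc (inj₁ p) _ (inj₁ r) = ac (trans p (sym r))
  pigeonhole-3-2 ab ac bc (inj₂ p) _ (inj₂ r) = ac (trans p (sym r))
  pigeonhole-3-2 ab ac bc _ (inj₁ q) (inj₁ r) = bc (trans q (sym r))
  pigeonhole-3-2 ab ac bc _ (inj₂ q) (inj₂ r) = bc (trans q (sym r))

  dominated-by : ∀ {s : State} {v u} → G ∈N[ v ] u → s u ≡ dom → Dominated s v
  dominated-by {u = u} h e = u , h , e

module WideBoard (m : ℕ) where
  n : ℕ
  n = suc (suc (suc m))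
  open Board n public

  j0 j1 j2 : Fin n
  j0 = fz
  j1 = fs fz
  j2 = fs (fs fz)

  other-neighbour : ∀ v → Σ Vertex λ u → G ∈N[ v ] u × u ≢ v
  other-neighbour v with view v
  ... | isA = la j0 , n-cl L0 j0 , (λ ())
  ... | isB = lb j0 , n-cl L1 j0 , (λ ())
  ... | isC = ld j0 , n-cl L2 j0 , (λ ())
  ... | isa j = cA , n-lc L0 j , (λ ())
  ... | isb j = cB , n-lc L1 j , (λ ())
  ... | isd j = cC , n-lc L2 j , (λ ())

  first-claim-¬StalWin : ∀ (s : State) w → (∀ u → s u ≢ stal) → ¬ StalWin (s [ w ≔ stal ])
  first-claim-¬StalWin s w ns (v , f) with upd-stal s w stal v (f v (n-self v))
  ... | inj₂ q = ns v q
  ... | inj₁ vw with other-neighbour v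
  ...   | u , hu , uv with upd-stal s w stal u (f u hu)
  ...     | inj₂ q = ns u q
  ...     | inj₁ uw = uv (trans uw (sym vw))

  -- Dominator wins the D-game in n + 2 moves

  -- Dominator opens with B. He answers a centre by the opposite centre and the pairing
  -- (la j , lb j), or its mirror image; he answers a leaf of column c by A, after which
  -- either C wins at once or he pairs (ld k , lb k) for k ≠ c and needs one more vertex of column c.

  afterB : State
  afterB = empty [ cB ≔ dom ]

  afterB-¬stal : ∀ u → afterB u ≢ stal
  afterB-¬stal u e = empty-nstal u (upd-stal-dom empty cB u e)

  afterB-A-C : State
  afterB-A-C = (afterB [ cA ≔ stal ]) [ cC ≔ dom ]

  abPairs : Pairs n
  abPairs i = (la i , lb i)

  abPairs-ok : IsPairing afterB-A-C abPairs
  abPairs-ok = record { proper = λ i () ; disj = dj ; free₁ = λ i → refl ; free₂ = λ i → refl }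
    where dj : ∀ i j u → u ∈P abPairs i → u ∈P abPairs j → i ≡ j
          dj i j u (inj₁ refl) (inj₁ q) = la-inj q
          dj i j u (inj₂ refl) (inj₂ q) = lb-inj q
          dj i j u (inj₁ refl) (inj₂ ())
          dj i j u (inj₂ refl) (inj₁ ())

  abPairs-cover : ∀ v → Dominated afterB-A-C v ⊎ PairIn abPairs v
  abPairs-cover v with view v
  ... | isA = inj₁ (dominated-by (n-01 fz) refl)
  ... | isB = inj₁ (dominated-by (n-self cB) refl)
  ... | isC = inj₁ (dominated-by (n-self cC) refl)
  ... | isa j = inj₂ (j , n-self (la j) , n-01 (fs j))
  ... | isb j = inj₁ (dominated-by (n-lc L1 j) refl)
  ... | isd j = inj₁ (dominated-by (n-lc L2 j) refl)

  reply-to-A : DTurn (suc n) (afterB [ cA ≔ stal ])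
  reply-to-A = cC , refl , inj₂ (pairing-STurn (suc (suc m)) afterB-A-C abPairs abPairs-ok abPairs-cover)

  reply-to-C : DTurn (suc n) (afterB [ cC ≔ stal ])
  reply-to-C = DTurn-ext (suc n) eq (DTurn-σ (suc n) reply-to-A)
    where eq : ((afterB [ cA ≔ stal ]) ∘σ) ≗ (afterB [ cC ≔ stal ])
          eq u with view u
          ... | isA = refl
          ... | isB = refl
          ... | isC = refl
          ... | isa j = refl
          ... | isb j = refl
          ... | isd j = refl


  dbPairs : Fin n → Pairs (suc (suc m))
  dbPairs c i = (ld (punchIn c i) , lb (punchIn c i))

  dbPairs-disj : ∀ c i j u → u ∈P dbPairs c i → u ∈P dbPairs c j → i ≡ j
  dbPairs-disj c i j u (inj₁ refl) (inj₁ q) = punchIn-injective c i j (ld-inj q)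
  dbPairs-disj c i j u (inj₂ refl) (inj₂ q) = punchIn-injective c i j (lb-inj q)
  dbPairs-disj c i j u (inj₁ refl) (inj₂ ())
  dbPairs-disj c i j u (inj₂ refl) (inj₁ ())

  column-cases : ∀ (c k : Fin n) → k ≡ c ⊎ ∃ λ i → k ≡ punchIn c i
  column-cases c k with k ≟F c
  ... | yes e = inj₁ e
  ... | no ne = inj₂ (punchOut (≢-sym ne) , sym (punchIn-punchOut (≢-sym ne)))

  reply-to-leaf : ∀ w → (afterB [ w ≔ stal ]) cA ≡ free → (afterB [ w ≔ stal ]) cB ≡ dom → (afterB [ w ≔ stal ]) cC ≡ free →
               DTurn n (((afterB [ w ≔ stal ]) [ cA ≔ dom ]) [ cC ≔ stal ]) →
               DTurn (suc n) (afterB [ w ≔ stal ])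
  reply-to-leaf w fA fB fC pd = cA , fA , inj₂ st3
    where
    s2 = afterB [ w ≔ stal ]
    s3 = s2 [ cA ≔ dom ]
    st3 : STurn n s3
    st3 y fy = nsw , dt
      where
      s4 = s3 [ y ≔ stal ]
      A4 : s4 cA ≡ dom
      A4 = upd-keeps s3 {y} stal {cA} fy (upd-eq s2 cA dom) dom≢free
      B4 : s4 cB ≡ dom
      B4 = upd-keeps s3 {y} stal {cB} fy fB dom≢free
      stset : ∀ u → s4 u ≡ stal → u ≡ y ⊎ u ≡ w
      stset u e with upd-stal s3 y stal u e
      ... | inj₁ q = inj₁ q
      ... | inj₂ q with upd-stal afterB w stal u (upd-stal-dom s2 cA u q)
      ...   | inj₁ q' = inj₂ q'
      ...   | inj₂ q' = ⊥-elim (afterB-¬stal u q')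
      nsw : ¬ StalWin s4
      nsw (v , f) with view v
      ... | isA = dom≢stal (trans (sym A4) (f cA (n-self cA)))
      ... | isa j = dom≢stal (trans (sym A4) (f cA (n-lc L0 j)))
      ... | isB = dom≢stal (trans (sym B4) (f cB (n-self cB)))
      ... | isb j = dom≢stal (trans (sym B4) (f cB (n-lc L1 j)))
      ... | isC = dom≢stal (trans (sym B4) (f cB (n-21 fz)))
      ... | isd j = pigeonhole-3-2 {ld j} {cC} {lb j} (λ ()) (λ ()) (λ ())
                        (stset _ (f _ (n-self (ld j)))) (stset _ (f _ (n-lc L2 j))) (stset _ (f _ (n-21 (fs j))))
      dt : DTurn n s4
      dt with y ≟V cC
      ... | yes e = subst (λ z → DTurn n (s3 [ z ≔ stal ])) (sym e) pd
      ... | no ne = cC , trans (upd-neq s3 stal (≢-sym ne)) fC , inj₁ dw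
        where
        dw : DomWin (s4 [ cC ≔ dom ])
        dw v with view v
        ... | isA = dominated-by (n-self cA) A4
        ... | isa j = dominated-by (n-lc L0 j) A4
        ... | isB = dominated-by (n-self cB) B4
        ... | isb j = dominated-by (n-lc L1 j) B4
        ... | isC = dominated-by {u = cC} (n-self cC) (upd-eq s4 cC dom)
        ... | isd j = dominated-by {u = cC} (n-lc L2 j) (upd-eq s4 cC dom)

  dbPairs-∌ : ∀ c x → (x ≡ lb c ⊎ x ≡ ld c) → ∀ i → ¬ x ∈P dbPairs c i
  dbPairs-∌ c .(lb c) (inj₁ refl) i (inj₂ q) = punchInᵢ≢i c i (sym (lb-inj q))
  dbPairs-∌ c .(ld c) (inj₂ refl) i (inj₁ q) = punchInᵢ≢i c i (sym (ld-inj q))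
  dbPairs-∌ c .(lb c) (inj₁ refl) i (inj₁ ())
  dbPairs-∌ c .(ld c) (inj₂ refl) i (inj₂ ())

  ∈N[ld]-of-column : ∀ c x → (x ≡ lb c ⊎ x ≡ ld c) → G ∈N[ ld c ] x
  ∈N[ld]-of-column c .(lb c) (inj₁ refl) = n-21 (fs c)
  ∈N[ld]-of-column c .(ld c) (inj₂ refl) = n-self _

  dbPairing-DTurn : ∀ (s : State) c x → (x ≡ lb c ⊎ x ≡ ld c) → s x ≡ free →
          (∀ i → s (ld (punchIn c i)) ≡ free) → (∀ i → s (lb (punchIn c i)) ≡ free) →
          s cA ≡ dom → s cB ≡ dom → DTurn n s
  dbPairing-DTurn s c x xc fx fd fb dA dB = pairing-DTurn (suc (suc m)) s x (dbPairs c) fx nx ok cov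
    where
    nx : ∀ i → ¬ x ∈P dbPairs c i
    nx = dbPairs-∌ c x xc
    ok : IsPairing s (dbPairs c)
    ok = record { proper = λ i () ; disj = dbPairs-disj c ; free₁ = fd ; free₂ = fb }
    cov : ∀ v → Dominated s v ⊎ G ∈N[ v ] x ⊎ PairIn (dbPairs c) v
    cov v with view v
    ... | isA = inj₁ (dominated-by {u = cA} (n-self cA) dA)
    ... | isa j = inj₁ (dominated-by {u = cA} (n-lc L0 j) dA)
    ... | isB = inj₁ (dominated-by {u = cB} (n-self cB) dB)
    ... | isb j = inj₁ (dominated-by {u = cB} (n-lc L1 j) dB)
    ... | isC = inj₁ (dominated-by {u = cB} (n-21 fz) dB)
    ... | isd k with column-cases c k
    ...   | inj₂ (i , refl) = inj₂ (inj₂ (i , n-self _ , n-21 _))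
    ...   | inj₁ refl = inj₂ (inj₁ (∈N[ld]-of-column c x xc))

  reply-to-la : ∀ c → DTurn (suc n) (afterB [ la c ≔ stal ])
  reply-to-la c = reply-to-leaf (la c) refl refl refl
    (dbPairing-DTurn _ c (lb c) (inj₁ refl) refl
       (λ i → refl) (λ i → refl) refl refl)

  reply-to-lb : ∀ c → DTurn (suc n) (afterB [ lb c ≔ stal ])
  reply-to-lb c = reply-to-leaf (lb c) refl refl refl
    (dbPairing-DTurn _ c (ld c) (inj₂ refl) refl
       (λ i → refl) (λ i → trans (upd-neq afterB stal (λ e → punchInᵢ≢i c i (lb-inj e))) refl) refl refl)

  reply-to-ld : ∀ c → DTurn (suc n) (afterB [ ld c ≔ stal ])
  reply-to-ld c = reply-to-leaf (ld c) refl refl refl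
    (dbPairing-DTurn _ c (lb c) (inj₁ refl) refl
       (λ i → trans (upd-neq afterB stal (λ e → punchInᵢ≢i c i (ld-inj e))) refl) (λ i → refl) refl refl)

  dominator-wins-D-game : DTurn (suc (suc n)) empty
  dominator-wins-D-game = cB , refl , inj₂ st1
    where
    st1 : STurn (suc n) afterB
    st1 w fw = first-claim-¬StalWin afterB w afterB-¬stal , dt w fw
      where
      dt : ∀ w → afterB w ≡ free → DTurn (suc n) (afterB [ w ≔ stal ])
      dt w fw with view w
      ... | isA = reply-to-A
      ... | isB = ⊥-elim (dom≢free fw)
      ... | isC = reply-to-C
      ... | isa c = reply-to-la c
      ... | isb c = reply-to-lb c
      ... | isd c = reply-to-ld c

  -- Staller wins the S-game in n + 2 moves

  -- Staller opens with A. If Dominator answers with C, every la j Staller claims is a threat,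
  -- and after the n forced answers lb j the vertex B completes N[A]. Otherwise Staller claims C,
  -- and lb k of a column k Dominator has not touched threatens both N[la k] and N[ld k].

  fresh-column : ∀ (x y : Fin (suc n)) → ∃ λ k → fs k ≢ x × fs k ≢ y
  fresh-column x y with fs j0 ≟F x | fs j0 ≟F y
  ... | no a | no b = j0 , a , b
  ... | yes refl | _ with fs j1 ≟F y
  ...   | no b = j1 , (λ ()) , b
  ...   | yes refl = j2 , (λ ()) , (λ ())
  fresh-column x y | no a | yes refl with fs j1 ≟F x
  ...   | no b = j1 , b , (λ ())
  ...   | yes refl = j2 , (λ ()) , (λ ())

  column-≢ : ∀ {u v : Vertex} → proj₂ u ≢ proj₂ v → u ≢ v
  column-≢ ne e = ne (cong proj₂ e)

  single-dom-¬DomWin : ∀ (s : State) v u → (∀ x → s x ≢ dom) → ¬ G ∈N[ u ] v → ¬ DomWin (s [ v ≔ dom ])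
  single-dom-¬DomWin s v u nd nu dw with dw u
  ... | x , hx , dx with upd-cases s v dom x
  ...   | inj₁ (e , _) = nu (subst (λ z → G ∈N[ u ] z) e hx)
  ...   | inj₂ (_ , q) = nd x (trans (sym q) dx)


  ChainInv : State → List (Fin n) → Set
  ChainInv s os = s cA ≡ stal × s cB ≡ free ×
              (∀ c → s (la c) ≡ stal ⊎ (c ∈ os × s (la c) ≡ free × s (lb c) ≡ free))

  ChainInv-¬DomWin : ∀ {s os} → ChainInv s os → ¬ DomWin s
  ChainInv-¬DomWin {s} (iA , iB , ic) dw with dw cA
  ... | u , hu , du with N[A]-cases u hu
  ...   | inj₁ refl = stal≢dom (trans (sym iA) du)
  ...   | inj₂ (inj₁ refl) = free≢dom (trans (sym iB) du)
  ...   | inj₂ (inj₂ (j , refl)) with ic j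
  ...     | inj₁ st = stal≢dom (trans (sym st) du)
  ...     | inj₂ (_ , fr , _) = free≢dom (trans (sym fr) du)

  threat-chain-SMove : ∀ os s → ChainInv s os → SMove (suc (length os)) s
  threat-chain-SMove [] s (iA , iB , ic) = cB , iB , inj₁ (cA , f)
    where f : ∀ u → G ∈N[ cA ] u → (s [ cB ≔ stal ]) u ≡ stal
          f u hu with N[A]-cases u hu
          ... | inj₁ refl = iA
          ... | inj₂ (inj₁ refl) = upd-eq s cB stal
          ... | inj₂ (inj₂ (j , refl)) with ic j
          ...   | inj₁ st = st
          ...   | inj₂ (() , _)
  threat-chain-SMove (c ∷ os) s (iA , iB , ic) with owner-≟ (s (la c)) stal
  ... | yes st = SMove-mono (suc (length os)) (threat-chain-SMove os s (iA , iB , ic'))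
    where ic' : ∀ c' → s (la c') ≡ stal ⊎ (c' ∈ os × s (la c') ≡ free × s (lb c') ≡ free)
          ic' c' with ic c'
          ... | inj₁ q = inj₁ q
          ... | inj₂ (here refl , _) = inj₁ st
          ... | inj₂ (there m , q) = inj₂ (m , q)
  ... | no nst with ic c
  ...   | inj₁ q = ⊥-elim (nst q)
  ...   | inj₂ (_ , fa , fb) = la c , fa , inj₂ (threat-DReply (length os) th cont)
    where
    s' = s [ la c ≔ stal ]
    s'' = s' [ lb c ≔ dom ]
    th : Threat s' (la c) (lb c)
    th = fb , λ u hu → case u (N[la]-cases c u hu)
      where case : ∀ u → u ≡ la c ⊎ u ≡ cA ⊎ u ≡ lb c → u ≡ lb c ⊎ s' u ≡ stal
            case u (inj₁ refl) = inj₂ (upd-eq s (la c) stal)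
            case u (inj₂ (inj₁ refl)) = inj₂ iA
            case u (inj₂ (inj₂ refl)) = inj₁ refl
    inv'' : ChainInv s'' os
    inv'' = iA , iB , ic''
      where ic'' : ∀ c' → s'' (la c') ≡ stal ⊎ (c' ∈ os × s'' (la c') ≡ free × s'' (lb c') ≡ free)
            ic'' c' = aux (c' ≟F c)
              where
              aux : Dec (c' ≡ c) → s'' (la c') ≡ stal ⊎ (c' ∈ os × s'' (la c') ≡ free × s'' (lb c') ≡ free)
              aux (yes refl) = inj₁ (upd-eq s (la c) stal)
              aux (no ne) with ic c'
              ... | inj₁ q = inj₁ (trans (upd-neq s stal (λ e → ne (la-inj e))) q)
              ... | inj₂ (here refl , _) = ⊥-elim (ne refl)
              ... | inj₂ (there mm , q1 , q2) = inj₂ (mm , trans (upd-neq s stal (λ e → ne (la-inj e))) q1 ,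
                        trans (upd-neq s' dom (λ e → ne (lb-inj e))) q2)
    cont : ¬ DomWin s'' × SMove (suc (length os)) s''
    cont = ChainInv-¬DomWin inv'' , threat-chain-SMove os s'' inv''


  na-a-B : ∀ j → ¬ G ∈N[ la j ] cB
  na-a-B j h with N[la]-cases j _ h
  ... | inj₁ ()
  ... | inj₂ (inj₁ ())
  ... | inj₂ (inj₂ ())
  na-a-C : ∀ j → ¬ G ∈N[ la j ] cC
  na-a-C j h with N[la]-cases j _ h
  ... | inj₁ ()
  ... | inj₂ (inj₁ ())
  ... | inj₂ (inj₂ ())
  na-d-a : ∀ j c → ¬ G ∈N[ ld j ] (la c)
  na-d-a j c h with N[ld]-cases j _ h
  ... | inj₁ ()
  ... | inj₂ (inj₁ ())
  ... | inj₂ (inj₂ ())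
  na-A-b : ∀ c → ¬ G ∈N[ cA ] (lb c)
  na-A-b c h with N[A]-cases _ h
  ... | inj₁ ()
  ... | inj₂ (inj₁ ())
  ... | inj₂ (inj₂ (_ , ()))
  na-d-A : ∀ j → ¬ G ∈N[ ld j ] cA
  na-d-A j h with N[ld]-cases j _ h
  ... | inj₁ ()
  ... | inj₂ (inj₁ ())
  ... | inj₂ (inj₂ ())

  na-A-d : ∀ c → ¬ G ∈N[ cA ] (ld c)
  na-A-d c h with N[A]-cases _ h
  ... | inj₁ ()
  ... | inj₂ (inj₁ ())
  ... | inj₂ (inj₂ (_ , ()))

  stalA : State
  stalA = empty [ cA ≔ stal ]

  take-C-then-double-threat : ∀ v → stalA v ≡ free → (stalA [ v ≔ dom ]) cC ≡ free → SMove (suc n) (stalA [ v ≔ dom ])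
  take-C-then-double-threat v fv fC = cC , fC , inj₂ dr2
    where
    t2 = (stalA [ v ≔ dom ]) [ cC ≔ stal ]
    vA : cA ≢ v
    vA e = stal≢free (trans (sym (upd-eq empty cA stal)) (trans (cong stalA e) fv))
    vC : cC ≢ v
    vC e = dom≢free (trans (sym (upd-eq stalA v dom)) (trans (cong (stalA [ v ≔ dom ]) (sym e)) fC))
    dr2 : DReply n t2
    dr2 v' fv' = ndw2 , sm2
      where
      k = proj₁ (fresh-column (proj₂ v) (proj₂ v'))
      kv = proj₁ (proj₂ (fresh-column (proj₂ v) (proj₂ v')))
      kv' = proj₂ (proj₂ (fresh-column (proj₂ v) (proj₂ v')))
      t3 = t2 [ v' ≔ dom ]
      A2 : t2 cA ≡ stal
      A2 = trans (upd-neq (stalA [ v ≔ dom ]) {cC} stal {cA} (λ ())) (trans (upd-neq stalA {v} dom {cA} vA) refl)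
      C2 : t2 cC ≡ stal
      C2 = upd-eq (stalA [ v ≔ dom ]) cC stal
      v'A : cA ≢ v'
      v'A e = stal≢free (trans (sym A2) (trans (cong t2 e) fv'))
      v'C : cC ≢ v'
      v'C e = stal≢free (trans (sym C2) (trans (cong t2 e) fv'))
      rd : ∀ u → u ≢ v' → u ≢ cC → u ≢ v → t3 u ≡ stalA u
      rd u a b c = trans (upd-neq t2 dom a) (trans (upd-neq (stalA [ v ≔ dom ]) stal b) (upd-neq stalA dom c))
      fa3 : t3 (la k) ≡ free
      fa3 = rd (la k) (column-≢ kv') (λ ()) (column-≢ kv)
      fb3 : t3 (lb k) ≡ free
      fb3 = rd (lb k) (column-≢ kv') (λ ()) (column-≢ kv)
      fd3 : t3 (ld k) ≡ free
      fd3 = rd (ld k) (column-≢ kv') (λ ()) (column-≢ kv)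
      A3 : t3 cA ≡ stal
      A3 = trans (upd-neq t2 dom v'A) A2
      C3 : t3 cC ≡ stal
      C3 = trans (upd-neq t2 dom v'C) C2
      ndw2 : ¬ DomWin t3
      ndw2 dw with dw (la k)
      ... | x , hx , dx with N[la]-cases k x hx
      ...   | inj₁ refl = free≢dom (trans (sym fa3) dx)
      ...   | inj₂ (inj₁ refl) = stal≢dom (trans (sym A3) dx)
      ...   | inj₂ (inj₂ refl) = free≢dom (trans (sym fb3) dx)
      t4 = t3 [ lb k ≔ stal ]
      th1 : Threat t4 (la k) (la k)
      th1 = trans (upd-neq t3 {lb k} stal {la k} (λ ())) fa3 , λ u hu → case (N[la]-cases k u hu)
        where case : ∀ {u} → u ≡ la k ⊎ u ≡ cA ⊎ u ≡ lb k → u ≡ la k ⊎ t4 u ≡ stal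
              case (inj₁ e) = inj₁ e
              case (inj₂ (inj₁ refl)) = inj₂ (trans (upd-neq t3 {lb k} stal {cA} (λ ())) A3)
              case (inj₂ (inj₂ refl)) = inj₂ (upd-eq t3 (lb k) stal)
      th2 : Threat t4 (ld k) (ld k)
      th2 = trans (upd-neq t3 {lb k} stal {ld k} (λ ())) fd3 , λ u hu → case (N[ld]-cases k u hu)
        where case : ∀ {u} → u ≡ ld k ⊎ u ≡ cC ⊎ u ≡ lb k → u ≡ ld k ⊎ t4 u ≡ stal
              case (inj₁ e) = inj₁ e
              case (inj₂ (inj₁ refl)) = inj₂ (trans (upd-neq t3 {lb k} stal {cC} (λ ())) C3)
              case (inj₂ (inj₂ refl)) = inj₂ (upd-eq t3 (lb k) stal)
      sm2 : SMove n t3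
      sm2 = lb k , fb3 , inj₂ (double-threat-DReply (suc m) th1 th2 (λ ()))

  staller-wins-S-game : SMove (suc (suc n)) empty
  staller-wins-S-game = cA , refl , inj₂ dr1
    where
    dr1 : DReply (suc n) stalA
    dr1 v fv with view v
    ... | isA = ⊥-elim (stal≢free fv)
    ... | isB = single-dom-¬DomWin stalA cB (la j0) (single-stal-¬dom cA) (na-a-B j0) , take-C-then-double-threat cB refl refl
    ... | isa c = single-dom-¬DomWin stalA (la c) (ld j0) (single-stal-¬dom cA) (na-d-a j0 c) , take-C-then-double-threat (la c) refl refl
    ... | isb c = single-dom-¬DomWin stalA (lb c) cA (single-stal-¬dom cA) (na-A-b c) , take-C-then-double-threat (lb c) refl refl
    ... | isd c = single-dom-¬DomWin stalA (ld c) cA (single-stal-¬dom cA) (na-A-d c) , take-C-then-double-threat (ld c) refl refl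
    ... | isC = single-dom-¬DomWin stalA cC (la j0) (single-stal-¬dom cA) (na-a-C j0) ,
                subst (λ z → SMove (suc z) (stalA [ cC ≔ dom ])) (length-tabulate (λ x → x))
                  (threat-chain-SMove (allFin n) (stalA [ cC ≔ dom ]) (refl , refl , λ c → inj₂ (∈-allFin c , refl , refl)))

  -- Dominator survives n + 1 Staller moves in the S-game

  -- Dominator answers with a centre and a pairing; at most one neighbourhood is left without a
  -- pair, and it keeps n + 1 free vertices.

  countA : Fin (suc n) → Vertex
  countA fz = cB
  countA (fs j) = la j

  countA-inj : ∀ i j → countA i ≡ countA j → i ≡ j
  countA-inj fz fz e = refl
  countA-inj fz (fs j) ()
  countA-inj (fs i) fz ()
  countA-inj (fs i) (fs j) e = cong fs (la-inj e)

  countA-in : ∀ i → G ∈N[ cA ] (countA i)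
  countA-in fz = n-01 fz
  countA-in (fs j) = n-cl L0 j

  countC : Fin (suc n) → Vertex
  countC fz = cC
  countC (fs j) = ld j

  countC-inj : ∀ i j → countC i ≡ countC j → i ≡ j
  countC-inj fz fz e = refl
  countC-inj fz (fs j) ()
  countC-inj (fs i) fz ()
  countC-inj (fs i) (fs j) e = cong fs (ld-inj e)

  countC-in : ∀ i → G ∈N[ cC ] (countC i)
  countC-in fz = n-self cC
  countC-in (fs j) = n-cl L2 j

  bdPairs : Pairs n
  bdPairs i = (lb i , ld i)

  bdPairs-disj : ∀ i j u → u ∈P bdPairs i → u ∈P bdPairs j → i ≡ j
  bdPairs-disj i j u (inj₁ refl) (inj₁ q) = lb-inj q
  bdPairs-disj i j u (inj₂ refl) (inj₂ q) = ld-inj q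
  bdPairs-disj i j u (inj₁ refl) (inj₂ ())
  bdPairs-disj i j u (inj₂ refl) (inj₁ ())

  defend-A : NotDReply n (empty [ cA ≔ stal ])
  defend-A = cC , refl , inj₂ (pairing-¬SMove n n s abPairs ok cov nd)
    where
    s = (empty [ cA ≔ stal ]) [ cC ≔ dom ]
    ok : IsPairing s abPairs
    ok = record { proper = λ i () ; disj = IsPairing.disj abPairs-ok ; free₁ = λ i → refl ; free₂ = λ i → refl }
    cov : Covered n s abPairs
    cov v with view v
    ... | isA = inj₂ (inj₂ (countA , countA-inj , λ i → countA-in i , fr i))
      where fr : ∀ i → s (countA i) ≡ free
            fr fz = refl
            fr (fs j) = refl
    ... | isB = inj₁ (dominated-by {u = cC} (n-12 fz) refl)
    ... | isC = inj₁ (dominated-by {u = cC} (n-self cC) refl)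
    ... | isa j = inj₂ (inj₁ (j , n-self _ , n-01 _))
    ... | isb j = inj₂ (inj₁ (j , n-10 _ , n-self _))
    ... | isd j = inj₁ (dominated-by {u = cC} (n-lc L2 j) refl)
    nd : ¬ DomWin s
    nd dw with dw cA
    ... | x , hx , dx with N[A]-cases x hx
    ...   | inj₁ refl = stal≢dom dx
    ...   | inj₂ (inj₁ refl) = free≢dom dx
    ...   | inj₂ (inj₂ (j , refl)) = free≢dom dx

  defend-C : NotDReply n (empty [ cC ≔ stal ])
  defend-C = NotDReply-σ n (upd-∘σ empty cC stal) defend-A

  C-undominated : ∀ (s : State) → s cC ≢ dom → s cB ≢ dom → (∀ j → s (ld j) ≢ dom) → ¬ DomWin s
  C-undominated s nC nB nd dw with dw cC
  ... | x , hx , dx with N[C]-cases x hx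
  ...   | inj₁ refl = nC dx
  ...   | inj₂ (inj₁ refl) = nB dx
  ...   | inj₂ (inj₂ (j , refl)) = nd j dx

  defend-with-A : ∀ w → (empty [ w ≔ stal ]) cA ≡ free → (∀ j → (empty [ w ≔ stal ]) (lb j) ≡ free) →
        (∀ j → (empty [ w ≔ stal ]) (ld j) ≡ free) → (empty [ w ≔ stal ]) cC ≡ free →
        NotDReply n (empty [ w ≔ stal ])
  defend-with-A w fA fb fd fC = cA , fA , inj₂ (pairing-¬SMove n n s bdPairs ok cov nd)
    where
    s0 = empty [ w ≔ stal ]
    s = s0 [ cA ≔ dom ]
    ok : IsPairing s bdPairs
    ok = record { proper = λ i () ; disj = bdPairs-disj ; free₁ = fb ; free₂ = fd }
    Adom : s cA ≡ dom
    Adom = upd-eq s0 cA dom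
    cov : Covered n s bdPairs
    cov v with view v
    ... | isA = inj₁ (dominated-by {u = cA} (n-self cA) Adom)
    ... | isa j = inj₁ (dominated-by {u = cA} (n-lc L0 j) Adom)
    ... | isB = inj₁ (dominated-by {u = cA} (n-10 fz) Adom)
    ... | isb j = inj₂ (inj₁ (j , n-self _ , n-12 _))
    ... | isd j = inj₂ (inj₁ (j , n-21 _ , n-self _))
    ... | isC = inj₂ (inj₂ (countC , countC-inj , λ i → countC-in i , fr i))
      where fr : ∀ i → s (countC i) ≡ free
            fr fz = fC
            fr (fs j) = fd j
    nd : ¬ DomWin s
    nd = C-undominated s (λ e → free≢dom (trans (sym fC) e))
                  (single-stal-¬dom w cB)
                  (λ j e → free≢dom (trans (sym (fd j)) e))

  lbPairs : Fin n → Pairs (suc n)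
  lbPairs c fz = (ld c , cC)
  lbPairs c (fs fz) = (cB , la c)
  lbPairs c (fs (fs i)) = (lb (punchIn c i) , ld (punchIn c i))

  lbPairs-proper : ∀ c i → proj₁ (lbPairs c i) ≢ proj₂ (lbPairs c i)
  lbPairs-proper c fz ()
  lbPairs-proper c (fs fz) ()
  lbPairs-proper c (fs (fs i)) ()

  lbPairs-disj : ∀ c i j u → u ∈P lbPairs c i → u ∈P lbPairs c j → i ≡ j
  lbPairs-disj c fz fz _ _ _ = refl
  lbPairs-disj c (fs fz) (fs fz) _ _ _ = refl
  lbPairs-disj c (fs (fs i)) (fs (fs j)) u (inj₁ refl) (inj₁ q) = cong (λ z → fs (fs z)) (punchIn-injective c i j (lb-inj q))
  lbPairs-disj c (fs (fs i)) (fs (fs j)) u (inj₂ refl) (inj₂ q) = cong (λ z → fs (fs z)) (punchIn-injective c i j (ld-inj q))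
  lbPairs-disj c (fs (fs i)) (fs (fs j)) u (inj₁ refl) (inj₂ ())
  lbPairs-disj c (fs (fs i)) (fs (fs j)) u (inj₂ refl) (inj₁ ())
  lbPairs-disj c fz (fs fz) u (inj₁ refl) (inj₁ ())
  lbPairs-disj c fz (fs fz) u (inj₁ refl) (inj₂ ())
  lbPairs-disj c fz (fs fz) u (inj₂ refl) (inj₁ ())
  lbPairs-disj c fz (fs fz) u (inj₂ refl) (inj₂ ())
  lbPairs-disj c (fs fz) fz u (inj₁ refl) (inj₁ ())
  lbPairs-disj c (fs fz) fz u (inj₁ refl) (inj₂ ())
  lbPairs-disj c (fs fz) fz u (inj₂ refl) (inj₁ ())
  lbPairs-disj c (fs fz) fz u (inj₂ refl) (inj₂ ())
  lbPairs-disj c fz (fs (fs j)) u (inj₁ refl) (inj₁ ())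
  lbPairs-disj c fz (fs (fs j)) u (inj₁ refl) (inj₂ q) = ⊥-elim (punchInᵢ≢i c j (sym (ld-inj q)))
  lbPairs-disj c fz (fs (fs j)) u (inj₂ refl) (inj₁ ())
  lbPairs-disj c fz (fs (fs j)) u (inj₂ refl) (inj₂ ())
  lbPairs-disj c (fs (fs i)) fz u (inj₁ refl) (inj₁ ())
  lbPairs-disj c (fs (fs i)) fz u (inj₂ refl) (inj₁ q) = ⊥-elim (punchInᵢ≢i c i (ld-inj q))
  lbPairs-disj c (fs (fs i)) fz u (inj₁ refl) (inj₂ ())
  lbPairs-disj c (fs (fs i)) fz u (inj₂ refl) (inj₂ ())
  lbPairs-disj c (fs fz) (fs (fs j)) u (inj₁ refl) (inj₁ ())
  lbPairs-disj c (fs fz) (fs (fs j)) u (inj₁ refl) (inj₂ ())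
  lbPairs-disj c (fs fz) (fs (fs j)) u (inj₂ refl) (inj₁ ())
  lbPairs-disj c (fs fz) (fs (fs j)) u (inj₂ refl) (inj₂ ())
  lbPairs-disj c (fs (fs i)) (fs fz) u (inj₁ refl) (inj₁ ())
  lbPairs-disj c (fs (fs i)) (fs fz) u (inj₁ refl) (inj₂ ())
  lbPairs-disj c (fs (fs i)) (fs fz) u (inj₂ refl) (inj₁ ())
  lbPairs-disj c (fs (fs i)) (fs fz) u (inj₂ refl) (inj₂ ())

  defend-lb : ∀ c → NotDReply n (empty [ lb c ≔ stal ])
  defend-lb c = cA , refl , inj₂ (pairing-¬SMove n (suc n) s (lbPairs c) ok cov nd)
    where
    s0 = empty [ lb c ≔ stal ]
    s = s0 [ cA ≔ dom ]
    Adom : s cA ≡ dom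
    Adom = refl
    f1 : ∀ i → s (proj₁ (lbPairs c i)) ≡ free
    f1 fz = refl
    f1 (fs fz) = refl
    f1 (fs (fs i)) = trans (upd-neq empty stal (λ e → punchInᵢ≢i c i (lb-inj e))) refl
    f2 : ∀ i → s (proj₂ (lbPairs c i)) ≡ free
    f2 fz = refl
    f2 (fs fz) = refl
    f2 (fs (fs i)) = refl
    ok : IsPairing s (lbPairs c)
    ok = record { proper = lbPairs-proper c ; disj = lbPairs-disj c ; free₁ = f1 ; free₂ = f2 }
    cov : Covered n s (lbPairs c)
    cov v with view v
    ... | isA = inj₁ (dominated-by {u = cA} (n-self cA) Adom)
    ... | isa j = inj₁ (dominated-by {u = cA} (n-lc L0 j) Adom)
    ... | isB = inj₁ (dominated-by {u = cA} (n-10 fz) Adom)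
    ... | isC = inj₂ (inj₁ (fz , n-cl L2 c , n-self cC))
    ... | isb j with column-cases c j
    ...   | inj₁ refl = inj₂ (inj₁ (fs fz , n-lc L1 c , n-10 _))
    ...   | inj₂ (i , refl) = inj₂ (inj₁ (fs (fs i) , n-self _ , n-12 _))
    cov v | isd j with column-cases c j
    ...   | inj₁ refl = inj₂ (inj₁ (fz , n-self _ , n-lc L2 c))
    ...   | inj₂ (i , refl) = inj₂ (inj₁ (fs (fs i) , n-21 _ , n-self _))
    nd : ¬ DomWin s
    nd dw with dw (ld c)
    ... | x , hx , dx with N[ld]-cases c x hx
    ...   | inj₁ refl = free≢dom dx
    ...   | inj₂ (inj₁ refl) = free≢dom dx
    ...   | inj₂ (inj₂ refl) = stal≢dom (trans (sym (upd-eq empty (lb c) stal)) dx)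

  dominator-survives-S-game : ¬ SMove (suc n) empty
  dominator-survives-S-game = ¬SMove-suc (λ w fw → first-claim-¬StalWin empty w empty-nstal , dr w fw)
    where
    dr : ∀ w → empty w ≡ free → NotDReply n (empty [ w ≔ stal ])
    dr w fw with view w
    ... | isA = defend-A
    ... | isC = defend-C
    ... | isB = defend-with-A cB refl (λ j → refl) (λ j → refl) refl
    ... | isa c = defend-with-A (la c) refl (λ j → refl) (λ j → refl) refl
    ... | isb c = defend-lb c
    ... | isd c = NotDReply-σ n (upd-∘σ empty (ld c) stal) (defend-with-A (la c) refl (λ j → refl) (λ j → refl) refl)

  -- Staller survives n + 1 Dominator moves in the D-game

  -- Staller answers Dominator's first move by A, or by a leaf ld j if he took A (mirror images
  -- for C and the la j). If Dominator then takes C, each la j Staller claims is a threat;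
  -- otherwise Staller takes C herself, and lb j of a column free of Dominator threatens both
  -- la j and ld j. Only for n = 3 can Dominator's first three moves meet every column, which is
  -- the endgame treated separately.

  lbFamily : ∀ K (s : State) (col : Fin (suc K) → Fin n) → (∀ i j → col i ≡ col j → i ≡ j) → s cB ≡ stal →
         (∀ i → s (la (col i)) ≢ dom × s (lb (col i)) ≢ dom × s (ld (col i)) ≢ dom) →
         (∀ i → ∃ λ u → G ∈N[ lb (col i) ] u × s u ≡ free) →
         UndominatedFamily K s (λ i → lb (col i))
  lbFamily K s col inj sB nd hf = nodom , disj , hf
    where
    nodom : ∀ i u → G ∈N[ lb (col i) ] u → s u ≢ dom
    nodom i u hu with N[lb]-cases (col i) u hu
    ... | inj₁ refl = proj₁ (proj₂ (nd i))
    ... | inj₂ (inj₁ refl) = λ e → stal≢dom (trans (sym sB) e)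
    ... | inj₂ (inj₂ (inj₁ refl)) = proj₁ (nd i)
    ... | inj₂ (inj₂ (inj₂ refl)) = proj₂ (proj₂ (nd i))
    disj : ∀ i j u → i ≢ j → G ∈N[ lb (col i) ] u → G ∈N[ lb (col j) ] u → s u ≢ free
    disj i j u ne h1 h2 with N[lb]-cases (col i) u h1 | N[lb]-cases (col j) u h2
    ... | inj₂ (inj₁ refl) | _ = λ e → stal≢free (trans (sym sB) e)
    ... | inj₁ refl | inj₁ q = ⊥-elim (ne (inj _ _ (lb-inj q)))
    ... | inj₂ (inj₂ (inj₁ refl)) | inj₂ (inj₂ (inj₁ q)) = ⊥-elim (ne (inj _ _ (la-inj q)))
    ... | inj₂ (inj₂ (inj₂ refl)) | inj₂ (inj₂ (inj₂ q)) = ⊥-elim (ne (inj _ _ (ld-inj q)))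
    ... | inj₁ refl | inj₂ (inj₁ ())
    ... | inj₁ refl | inj₂ (inj₂ (inj₁ ()))
    ... | inj₁ refl | inj₂ (inj₂ (inj₂ ()))
    ... | inj₂ (inj₂ (inj₁ refl)) | inj₁ ()
    ... | inj₂ (inj₂ (inj₁ refl)) | inj₂ (inj₁ ())
    ... | inj₂ (inj₂ (inj₁ refl)) | inj₂ (inj₂ (inj₂ ()))
    ... | inj₂ (inj₂ (inj₂ refl)) | inj₁ ()
    ... | inj₂ (inj₂ (inj₂ refl)) | inj₂ (inj₁ ())
    ... | inj₂ (inj₂ (inj₂ refl)) | inj₂ (inj₂ (inj₁ ()))

  ldFamily : ∀ K (s : State) (col : Fin (suc K) → Fin n) → (∀ i j → col i ≡ col j → i ≡ j) → s cC ≡ stal →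
         (∀ i → s (lb (col i)) ≢ dom × s (ld (col i)) ≢ dom) →
         (∀ i → ∃ λ u → G ∈N[ ld (col i) ] u × s u ≡ free) →
         UndominatedFamily K s (λ i → ld (col i))
  ldFamily K s col inj sC nd hf = nodom , disj , hf
    where
    nodom : ∀ i u → G ∈N[ ld (col i) ] u → s u ≢ dom
    nodom i u hu with N[ld]-cases (col i) u hu
    ... | inj₁ refl = proj₂ (nd i)
    ... | inj₂ (inj₁ refl) = λ e → stal≢dom (trans (sym sC) e)
    ... | inj₂ (inj₂ refl) = proj₁ (nd i)
    disj : ∀ i j u → i ≢ j → G ∈N[ ld (col i) ] u → G ∈N[ ld (col j) ] u → s u ≢ free
    disj i j u ne h1 h2 with N[ld]-cases (col i) u h1 | N[ld]-cases (col j) u h2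
    ... | inj₂ (inj₁ refl) | _ = λ e → stal≢free (trans (sym sC) e)
    ... | inj₁ refl | inj₁ q = ⊥-elim (ne (inj _ _ (ld-inj q)))
    ... | inj₂ (inj₂ refl) | inj₂ (inj₂ q) = ⊥-elim (ne (inj _ _ (lb-inj q)))
    ... | inj₁ refl | inj₂ (inj₁ ())
    ... | inj₁ refl | inj₂ (inj₂ ())
    ... | inj₂ (inj₂ refl) | inj₁ ()
    ... | inj₂ (inj₂ refl) | inj₂ (inj₁ ())

  -- ExtraMove 1 s : B is free and Dominator owns no la j, so N[A] survives one move longer.
  data ExtraMove : ℕ → State → Set where
    no-extra : ∀ {s} → ExtraMove 0 s
    extra : ∀ {s} → s cB ≡ free → (∀ j → s (la j) ≢ dom) → ExtraMove 1 s

  threat-chain-¬DTurn : ∀ L e s t (os : Fin L → Fin n) → s cA ≡ stal → s (la t) ≡ stal → s (lb t) ≡ free →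
           (∀ i → os i ≢ t) → (∀ i j → os i ≡ os j → i ≡ j) →
           (∀ i → s (la (os i)) ≡ free × s (lb (os i)) ≡ free) → ExtraMove e s → ¬ DTurn (L + e) s
  threat-chain-¬DTurn zero .0 s t os sA st fb nt inj fr no-extra ()
  threat-chain-¬DTurn zero .1 s t os sA st fb nt inj fr (extra fB nla) =
    threat-¬DTurn 0 th (ndw , cB , fB , inj₂ (λ ()))
    where
    th : Threat s (la t) (lb t)
    th = fb , λ u hu → case (N[la]-cases t u hu)
      where case : ∀ {u} → u ≡ la t ⊎ u ≡ cA ⊎ u ≡ lb t → u ≡ lb t ⊎ s u ≡ stal
            case (inj₁ refl) = inj₂ st
            case (inj₂ (inj₁ refl)) = inj₂ sA
            case (inj₂ (inj₂ e)) = inj₁ e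
    s' = s [ lb t ≔ dom ]
    ndw : ¬ DomWin s'
    ndw dw with dw cA
    ... | x , hx , dx with N[A]-cases x hx
    ...   | inj₁ refl = stal≢dom (trans (sym sA) dx)
    ...   | inj₂ (inj₁ refl) = free≢dom (trans (sym fB) dx)
    ...   | inj₂ (inj₂ (j , refl)) = nla j dx
  threat-chain-¬DTurn (suc L) e s t os sA st fb nt inj fr ef =
    threat-¬DTurn (L + e) th (ndw , la c , proj₁ (fr fz) , inj₂ ih)
    where
    c = os fz
    th : Threat s (la t) (lb t)
    th = fb , λ u hu → case (N[la]-cases t u hu)
      where case : ∀ {u} → u ≡ la t ⊎ u ≡ cA ⊎ u ≡ lb t → u ≡ lb t ⊎ s u ≡ stal
            case (inj₁ refl) = inj₂ st
            case (inj₂ (inj₁ refl)) = inj₂ sA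
            case (inj₂ (inj₂ e)) = inj₁ e
    s' = s [ lb t ≔ dom ]
    s'' = s' [ la c ≔ stal ]
    nct : ∀ i → lb (os i) ≢ lb t
    nct i e = nt i (lb-inj e)
    fbc : s' (lb c) ≡ free
    fbc = trans (upd-neq s dom (nct fz)) (proj₂ (fr fz))
    ndw : ¬ DomWin s'
    ndw dw with dw (la c)
    ... | x , hx , dx with N[la]-cases c x hx
    ...   | inj₁ refl = free≢dom (trans (sym (proj₁ (fr fz))) dx)
    ...   | inj₂ (inj₁ refl) = stal≢dom (trans (sym sA) dx)
    ...   | inj₂ (inj₂ refl) = free≢dom (trans (sym fbc) dx)
    nc : ∀ i → os (fs i) ≢ c
    nc i e with inj (fs i) fz e
    ... | ()
    efu : ∀ {e'} → ExtraMove e' s → ExtraMove e' s''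
    efu no-extra = no-extra
    efu (extra fB nla) = extra fB (λ j → upd-ndom s' (la c) stal (la j) stal≢dom (nla j))
    ef'' : ExtraMove e s''
    ef'' = efu ef
    ih : ¬ DTurn (L + e) s''
    ih = threat-chain-¬DTurn L e s'' c (λ i → os (fs i)) sA (upd-eq s' (la c) stal) fbc
           nc (λ i j q → suc-injective (inj (fs i) (fs j) q))
           (λ i → trans (upd-neq s' stal (λ q → nc i (la-inj q))) (proj₁ (fr (fs i))) ,
                  trans (upd-neq s dom (nct (fs i))) (proj₂ (fr (fs i))))
           ef''

  InColumn : Vertex → Fin n → Set
  InColumn v x = v ≡ la x ⊎ v ≡ lb x ⊎ v ≡ ld x

  InColumn-≢ : ∀ {v x} → InColumn v x → ∀ j → j ≢ x → (v ≢ la j) × (v ≢ lb j) × (v ≢ ld j)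
  InColumn-≢ (inj₁ refl) j ne = (λ e → ne (sym (la-inj e))) , (λ ()) , (λ ())
  InColumn-≢ (inj₂ (inj₁ refl)) j ne = (λ ()) , (λ e → ne (sym (lb-inj e))) , (λ ())
  InColumn-≢ (inj₂ (inj₂ refl)) j ne = (λ ()) , (λ ()) , (λ e → ne (sym (ld-inj e)))

  InColumn-≢cA : ∀ {v x} → InColumn v x → v ≢ cA
  InColumn-≢cA (inj₁ refl) ()
  InColumn-≢cA (inj₂ (inj₁ refl)) ()
  InColumn-≢cA (inj₂ (inj₂ refl)) ()
  InColumn-≢cB : ∀ {v x} → InColumn v x → v ≢ cB
  InColumn-≢cB (inj₁ refl) ()
  InColumn-≢cB (inj₂ (inj₁ refl)) ()
  InColumn-≢cB (inj₂ (inj₂ refl)) ()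
  InColumn-≢cC : ∀ {v x} → InColumn v x → v ≢ cC
  InColumn-≢cC (inj₁ refl) ()
  InColumn-≢cC (inj₂ (inj₁ refl)) ()
  InColumn-≢cC (inj₂ (inj₂ refl)) ()

  free-InColumn-≢ld : ∀ (s : State) {v x} → InColumn v x → s (ld x) ≡ stal → s v ≡ free → ∀ j → ld j ≢ v
  free-InColumn-≢ld s (inj₁ refl) dp fv j ()
  free-InColumn-≢ld s (inj₂ (inj₁ refl)) dp fv j ()
  free-InColumn-≢ld s (inj₂ (inj₂ refl)) dp fv j e = stal≢free (trans (sym dp) fv)

  chainColumns : ∀ {L} → Fin n → (Fin L → Fin n) → Fin (suc L) → Fin n
  chainColumns p q fz = p
  chainColumns p q (fs i) = q i

  chainColumns-inj : ∀ {L} p (q : Fin L → Fin n) → (∀ i → q i ≢ p) → (∀ i j → q i ≡ q j → i ≡ j) →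
                     ∀ i j → chainColumns p q i ≡ chainColumns p q j → i ≡ j
  chainColumns-inj p q qp qinj fz fz e = refl
  chainColumns-inj p q qp qinj fz (fs j) e = ⊥-elim (qp j (sym e))
  chainColumns-inj p q qp qinj (fs i) fz e = ⊥-elim (qp i e)
  chainColumns-inj p q qp qinj (fs i) (fs j) e = cong fs (qinj i j e)

  ld-chain-reply-C : ∀ L (s : State) p (q : Fin L → Fin n) → s cB ≡ free →
                     s (ld p) ≡ stal → s (la p) ≡ free → s (lb p) ≡ free →
                     (∀ i → q i ≢ p) → (∀ i j → q i ≡ q j → i ≡ j) →
                     (∀ i → s (la (q i)) ≡ free × s (lb (q i)) ≡ free × s (ld (q i)) ≡ free) →
                     ¬ DomWin (s [ cC ≔ dom ]) × NotSTurn L (s [ cC ≔ dom ])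
  ld-chain-reply-C L s p q sB dp ap bp qp qinj qf =
    ndw , cB , sB , inj₂ (family-¬DTurn L s2 (λ i → lb (chainColumns p q i))
      (lbFamily L s2 (chainColumns p q) (chainColumns-inj p q qp qinj) (upd-eq (s [ cC ≔ dom ]) cB stal) ndc hf))
    where
    s2 = (s [ cC ≔ dom ]) [ cB ≔ stal ]
    ndw : ¬ DomWin (s [ cC ≔ dom ])
    ndw dw with dw (lb p)
    ... | x , hx , dx with N[lb]-cases p x hx
    ...   | inj₁ refl = free≢dom (trans (sym bp) dx)
    ...   | inj₂ (inj₁ refl) = free≢dom (trans (sym sB) dx)
    ...   | inj₂ (inj₂ (inj₁ refl)) = free≢dom (trans (sym ap) dx)
    ...   | inj₂ (inj₂ (inj₂ refl)) = stal≢dom (trans (sym dp) dx)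
    ndc : ∀ i → s2 (la (chainColumns p q i)) ≢ dom × s2 (lb (chainColumns p q i)) ≢ dom × s2 (ld (chainColumns p q i)) ≢ dom
    ndc fz = (λ e → free≢dom (trans (sym ap) e)) , (λ e → free≢dom (trans (sym bp) e)) , (λ e → stal≢dom (trans (sym dp) e))
    ndc (fs i) = (λ e → free≢dom (trans (sym (proj₁ (qf i))) e)) , (λ e → free≢dom (trans (sym (proj₁ (proj₂ (qf i)))) e)) ,
                 (λ e → free≢dom (trans (sym (proj₂ (proj₂ (qf i)))) e))
    hf : ∀ i → ∃ λ u → G ∈N[ lb (chainColumns p q i) ] u × s2 u ≡ free
    hf fz = lb p , n-self _ , bp
    hf (fs i) = lb (q i) , n-self _ , proj₁ (proj₂ (qf i))

  ld-chain-reply-B : ∀ L (s : State) p (q : Fin L → Fin n) → s cC ≡ free →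
                     s (ld p) ≡ stal → s (lb p) ≡ free →
                     (∀ i → q i ≢ p) → (∀ i j → q i ≡ q j → i ≡ j) →
                     (∀ i → s (la (q i)) ≡ free × s (lb (q i)) ≡ free × s (ld (q i)) ≡ free) →
                     ¬ DomWin (s [ cB ≔ dom ]) × NotSTurn L (s [ cB ≔ dom ])
  ld-chain-reply-B L s p q sC dp bp qp qinj qf =
    ndw , cC , sC , inj₂ (family-¬DTurn L s2 (λ i → ld (chainColumns p q i))
      (ldFamily L s2 (chainColumns p q) (chainColumns-inj p q qp qinj) (upd-eq (s [ cB ≔ dom ]) cC stal) ndc hf))
    where
    s2 = (s [ cB ≔ dom ]) [ cC ≔ stal ]
    ndw : ¬ DomWin (s [ cB ≔ dom ])
    ndw dw with dw (ld p)
    ... | x , hx , dx with N[ld]-cases p x hx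
    ...   | inj₁ refl = stal≢dom (trans (sym dp) dx)
    ...   | inj₂ (inj₁ refl) = free≢dom (trans (sym sC) dx)
    ...   | inj₂ (inj₂ refl) = free≢dom (trans (sym bp) dx)
    ndc : ∀ i → s2 (lb (chainColumns p q i)) ≢ dom × s2 (ld (chainColumns p q i)) ≢ dom
    ndc fz = (λ e → free≢dom (trans (sym bp) e)) , (λ e → stal≢dom (trans (sym dp) e))
    ndc (fs i) = (λ e → free≢dom (trans (sym (proj₁ (proj₂ (qf i)))) e)) ,
                 (λ e → free≢dom (trans (sym (proj₂ (proj₂ (qf i)))) e))
    hf : ∀ i → ∃ λ u → G ∈N[ ld (chainColumns p q i) ] u × s2 u ≡ free
    hf fz = lb p , n-21 _ , bp
    hf (fs i) = lb (q i) , n-21 _ , proj₁ (proj₂ (qf i))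

  -- Staller answers a move in column p by the next ld (q i). Against any other move she claims
  -- B or C (after lb p, which forces Dominator onto C) and keeps one undominated N[lb j] or
  -- N[ld j] per remaining column.
  ld-chain-¬DTurn : ∀ L s p (q : Fin L → Fin n) → s cA ≡ dom → s cB ≡ free → s cC ≡ free → (∀ j → s (ld j) ≢ dom) →
         s (ld p) ≡ stal → s (la p) ≡ free → s (lb p) ≡ free →
         (∀ i → q i ≢ p) → (∀ i j → q i ≡ q j → i ≡ j) →
         (∀ i → s (la (q i)) ≡ free × s (lb (q i)) ≡ free × s (ld (q i)) ≡ free) →
         ¬ DTurn (suc L) s
  ld-chain-¬DTurn L s p q sA sB sC nd dp ap bp qp qinj qf = ¬DTurn-suc step
    where
    colStep : ∀ v x → InColumn v x → s v ≡ free → ¬ DomWin (s [ v ≔ dom ]) × NotSTurn L (s [ v ≔ dom ])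
    colStep v x iv fv = main (x ≟F p)
      where
      u1 = s [ v ≔ dom ]
      rd : ∀ u → u ≢ v → u1 u ≡ s u
      rd u ne = upd-neq s dom ne
      vA : cA ≢ v
      vA e = InColumn-≢cA iv (sym e)
      vB : cB ≢ v
      vB e = InColumn-≢cB iv (sym e)
      vC : cC ≢ v
      vC e = InColumn-≢cC iv (sym e)
      main : Dec (x ≡ p) → ¬ DomWin u1 × NotSTurn L u1
      main (yes refl) = ndw , cont L q qp qinj qf refl
        where
        notd : ∀ j → ld j ≢ v
        notd = free-InColumn-≢ld s iv dp fv
        ndw : ¬ DomWin u1
        ndw dw with dw cC
        ... | u , hu , du with N[C]-cases u hu
        ...   | inj₁ refl = free≢dom (trans (sym (trans (rd cC vC) sC)) du)
        ...   | inj₂ (inj₁ refl) = free≢dom (trans (sym (trans (rd cB vB) sB)) du)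
        ...   | inj₂ (inj₂ (j , refl)) = nd j (trans (sym (rd (ld j) (notd j))) du)
        cont : ∀ L' (q' : Fin L' → Fin n) → (∀ i → q' i ≢ p) → (∀ i j → q' i ≡ q' j → i ≡ j) →
               (∀ i → s (la (q' i)) ≡ free × s (lb (q' i)) ≡ free × s (ld (q' i)) ≡ free) → L' ≡ L → NotSTurn L u1
        cont zero q' _ _ _ refl = cB , trans (rd cB vB) sB , inj₂ (λ ())
        cont (suc L') q' qp' qinj' qf' refl =
          ld q0 , trans (rd (ld q0) (notd q0)) (proj₂ (proj₂ (qf' fz))) ,
          inj₂ (ld-chain-¬DTurn L' u1' q0 (λ i → q' (fs i))
                  (trans (upd-neq u1 {ld q0} stal {_} (λ ())) (trans (rd cA vA) sA))
                  (trans (upd-neq u1 {ld q0} stal {_} (λ ())) (trans (rd cB vB) sB))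
                  (trans (upd-neq u1 {ld q0} stal {_} (λ ())) (trans (rd cC vC) sC))
                  (λ j e → nd j (trans (sym (rd (ld j) (notd j))) (nds j e)))
                  (upd-eq u1 (ld q0) stal)
                  (trans (upd-neq u1 {ld q0} stal {_} (λ ())) (trans (rd (la q0) (λ e → proj₁ (InColumn-≢ iv q0 (qp' fz)) (sym e))) (proj₁ (qf' fz))))
                  (trans (upd-neq u1 {ld q0} stal {_} (λ ())) (trans (rd (lb q0) (λ e → proj₁ (proj₂ (InColumn-≢ iv q0 (qp' fz))) (sym e))) (proj₁ (proj₂ (qf' fz)))))
                  (λ i e → ne0 i e)
                  (λ i j e → suc-injective (qinj' (fs i) (fs j) e))
                  (λ i → let c = q' (fs i) ; cn = InColumn-≢ iv c (qp' (fs i)) in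
                         trans (upd-neq u1 {ld q0} stal {_} (λ ())) (trans (rd (la c) (λ e → proj₁ cn (sym e))) (proj₁ (qf' (fs i)))) ,
                         trans (upd-neq u1 {ld q0} stal {_} (λ ())) (trans (rd (lb c) (λ e → proj₁ (proj₂ cn) (sym e))) (proj₁ (proj₂ (qf' (fs i))))) ,
                         trans (upd-neq u1 {ld q0} stal {_} (λ e → ne0 i (ld-inj e))) (trans (rd (ld c) (λ e → proj₂ (proj₂ cn) (sym e))) (proj₂ (proj₂ (qf' (fs i)))))))
          where
          q0 = q' fz
          u1' = u1 [ ld q0 ≔ stal ]
          ne0 : ∀ i → q' (fs i) ≢ q0
          ne0 i e with qinj' (fs i) fz e
          ... | ()
          nds : ∀ j → u1' (ld j) ≡ dom → u1 (ld j) ≡ dom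
          nds j e with upd-cases u1 (ld q0) stal (ld j)
          ... | inj₁ (_ , r) = ⊥-elim (stal≢dom (trans (sym r) e))
          ... | inj₂ (_ , r) = trans (sym r) e
      main (no xp) = ndw , lb p , fbp , inj₂ (nd3 L q qp qinj qf refl)
        where
        cnp = InColumn-≢ iv p (≢-sym xp)
        vla : la p ≢ v
        vla e = proj₁ cnp (sym e)
        vlb : lb p ≢ v
        vlb e = proj₁ (proj₂ cnp) (sym e)
        vld : ld p ≢ v
        vld e = proj₂ (proj₂ cnp) (sym e)
        fbp : u1 (lb p) ≡ free
        fbp = trans (rd (lb p) vlb) bp
        ndw : ¬ DomWin u1
        ndw dw with dw (ld p)
        ... | u , hu , du with N[ld]-cases p u hu
        ...   | inj₁ refl = stal≢dom (trans (sym (trans (rd (ld p) vld) dp)) du)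
        ...   | inj₂ (inj₁ refl) = free≢dom (trans (sym (trans (rd cC vC) sC)) du)
        ...   | inj₂ (inj₂ refl) = free≢dom (trans (sym fbp) du)
        nd3 : ∀ L' (q' : Fin L' → Fin n) → (∀ i → q' i ≢ p) → (∀ i j → q' i ≡ q' j → i ≡ j) →
              (∀ i → s (la (q' i)) ≡ free × s (lb (q' i)) ≡ free × s (ld (q' i)) ≡ free) → L' ≡ L →
              ¬ DTurn L (u1 [ lb p ≔ stal ])
        nd3 zero q' _ _ _ refl ()
        nd3 (suc L') q' qp' qinj' qf' refl = threat-¬DTurn L' th (ndw3 , cB , fB4 , inj₂ (family-¬DTurn L' u5 (λ i → lb (col' i)) fam))
          where
          u3 = u1 [ lb p ≔ stal ]
          u4 = u3 [ cC ≔ dom ]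
          u5 = u4 [ cB ≔ stal ]
          th : Threat u3 (ld p) cC
          th = trans (upd-neq u1 {lb p} stal {cC} (λ ())) (trans (rd cC vC) sC) , λ u hu → case (N[ld]-cases p u hu)
            where case : ∀ {u} → u ≡ ld p ⊎ u ≡ cC ⊎ u ≡ lb p → u ≡ cC ⊎ u3 u ≡ stal
                  case (inj₁ refl) = inj₂ (trans (upd-neq u1 {lb p} stal {ld p} (λ ())) (trans (rd (ld p) vld) dp))
                  case (inj₂ (inj₁ e)) = inj₁ e
                  case (inj₂ (inj₂ refl)) = inj₂ (upd-eq u1 (lb p) stal)
          fB4 : u4 cB ≡ free
          fB4 = trans (upd-neq u1 {lb p} stal {cB} (λ ())) (trans (rd cB vB) sB)
          ndw3 : ¬ DomWin u4
          ndw3 dw with dw (lb p)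
          ... | u , hu , du with N[lb]-cases p u hu
          ...   | inj₁ refl = stal≢dom (trans (sym (upd-eq u1 (lb p) stal)) du)
          ...   | inj₂ (inj₁ refl) = free≢dom (trans (sym fB4) du)
          ...   | inj₂ (inj₂ (inj₁ refl)) = free≢dom (trans (sym (trans (rd (la p) vla) ap)) du)
          ...   | inj₂ (inj₂ (inj₂ refl)) = stal≢dom (trans (sym (trans (upd-neq u1 {lb p} stal {ld p} (λ ())) (trans (rd (ld p) vld) dp))) du)
          pickR : Dec (∃ λ i → q' i ≡ x) → Σ (Fin (suc L')) λ r → ∀ i → q' (punchIn r i) ≢ x
          pickR (yes (r , e)) = r , λ i e' → punchInᵢ≢i r i (qinj' _ _ (trans e' (sym e)))
          pickR (no h) = fz , λ i e' → h (punchIn fz i , e')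
          R = pickR (any? (λ i → q' i ≟F x))
          r = proj₁ R
          col' : Fin (suc L') → Fin n
          col' = chainColumns p (λ i → q' (punchIn r i))
          inj' : ∀ i j → col' i ≡ col' j → i ≡ j
          inj' = chainColumns-inj p _ (λ i → qp' _) (λ i j e → punchIn-injective r i j (qinj' _ _ e))
          rd5 : ∀ y → y ≢ cB → y ≢ cC → y ≢ lb p → y ≢ v → u5 y ≡ s y
          rd5 y a b c d = trans (upd-neq u4 {cB} stal {y} a) (trans (upd-neq u3 {cC} dom {y} b) (trans (upd-neq u1 {lb p} stal {y} c) (rd y d)))
          cq : ∀ i → (la (q' (punchIn r i)) ≢ v) × (lb (q' (punchIn r i)) ≢ v) × (ld (q' (punchIn r i)) ≢ v)
          cq i = let z = InColumn-≢ iv (q' (punchIn r i)) (proj₂ R i) in (λ e → proj₁ z (sym e)) , (λ e → proj₁ (proj₂ z) (sym e)) , (λ e → proj₂ (proj₂ z) (sym e))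
          nlbp : ∀ i → lb (q' (punchIn r i)) ≢ lb p
          nlbp i e = qp' _ (lb-inj e)
          nd' : ∀ i → u5 (la (col' i)) ≢ dom × u5 (lb (col' i)) ≢ dom × u5 (ld (col' i)) ≢ dom
          nd' fz = (λ e → free≢dom (trans (sym (trans (rd5 (la p) (λ ()) (λ ()) (λ ()) vla) ap)) e)) ,
                   (λ e → stal≢dom (trans (sym (upd-eq u1 (lb p) stal)) e)) ,
                   (λ e → stal≢dom (trans (sym (trans (rd5 (ld p) (λ ()) (λ ()) (λ ()) vld) dp)) e))
          nd' (fs i) = (λ e → free≢dom (trans (sym (trans (rd5 _ (λ ()) (λ ()) (λ ()) (proj₁ (cq i))) (proj₁ (qf' _)))) e)) ,
                       (λ e → free≢dom (trans (sym (trans (rd5 _ (λ ()) (λ ()) (nlbp i) (proj₁ (proj₂ (cq i)))) (proj₁ (proj₂ (qf' _))))) e)) ,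
                       (λ e → free≢dom (trans (sym (trans (rd5 _ (λ ()) (λ ()) (λ ()) (proj₂ (proj₂ (cq i)))) (proj₂ (proj₂ (qf' _))))) e))
          hf' : ∀ i → ∃ λ u → G ∈N[ lb (col' i) ] u × u5 u ≡ free
          hf' fz = la p , n-10 _ , trans (rd5 (la p) (λ ()) (λ ()) (λ ()) vla) ap
          hf' (fs i) = lb (q' (punchIn r i)) , n-self _ , trans (rd5 _ (λ ()) (λ ()) (nlbp i) (proj₁ (proj₂ (cq i)))) (proj₁ (proj₂ (qf' _)))
          fam : UndominatedFamily L' u5 (λ i → lb (col' i))
          fam = lbFamily L' u5 col' inj' (upd-eq u4 cB stal) nd' hf'

    step : ∀ v → s v ≡ free → ¬ DomWin (s [ v ≔ dom ]) × NotSTurn L (s [ v ≔ dom ])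
    step v fv with view v
    ... | isA = ⊥-elim (dom≢free (trans (sym sA) fv))
    ... | isC = ld-chain-reply-C L s p q sB dp ap bp qp qinj qf
    ... | isB = ld-chain-reply-B L s p q sC dp bp qp qinj qf
    ... | isa x = colStep (la x) x (inj₁ refl) fv
    ... | isb x = colStep (lb x) x (inj₂ (inj₁ refl)) fv
    ... | isd x = colStep (ld x) x (inj₂ (inj₂ refl)) fv

  la1≢la0 : la j1 ≢ la j0
  la1≢la0 ()

  lb≢cB : ∀ j → lb j ≢ cB
  lb≢cB j ()

  module ThreeColumnEndgame (t : State) (tA : t cA ≡ stal) (tC : t cC ≡ stal)
                 (tst : ∀ u → t u ≡ stal → u ≡ cA ⊎ u ≡ cC)
                 (nocen : ∀ u → t u ≡ dom → proj₂ u ≢ fz)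
                 (uc : ∀ u u' → t u ≡ dom → t u' ≡ dom → proj₂ u ≡ proj₂ u' → u ≡ u') where

    fr : ∀ u → t u ≢ dom → u ≢ cA → u ≢ cC → t u ≡ free
    fr u nd na nc = owner-free (t u) nd (λ e → sel (tst u e))
      where sel : u ≡ cA ⊎ u ≡ cC → ⊥
            sel (inj₁ a) = na a
            sel (inj₂ b) = nc b

    ndB : t cB ≢ dom
    ndB e = nocen cB e refl

    fB : t cB ≡ free
    fB = fr cB ndB (λ ()) (λ ())

    sameCol : ∀ {u u'} → t u ≡ dom → proj₂ u ≡ proj₂ u' → u ≢ u' → t u' ≢ dom
    sameCol du e ne du' = ne (uc _ _ du du' e)

    r1 : ∀ j → t (la j) ≡ dom → ¬ DomWin t × NotSTurn 1 t
    r1 j laj = ndw , ld j , fd , inj₂ (¬DTurn-suc step)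
      where
      ndb : t (lb j) ≢ dom
      ndb = sameCol laj refl (λ ())
      ndd : t (ld j) ≢ dom
      ndd = sameCol laj refl (λ ())
      fd : t (ld j) ≡ free
      fd = fr (ld j) ndd (λ ()) (λ ())
      fb : t (lb j) ≡ free
      fb = fr (lb j) ndb (λ ()) (λ ())
      ndw : ¬ DomWin t
      ndw dw with dw (ld j)
      ... | x , hx , dx with N[ld]-cases j x hx
      ...   | inj₁ refl = ndd dx
      ...   | inj₂ (inj₁ refl) = stal≢dom (trans (sym tC) dx)
      ...   | inj₂ (inj₂ refl) = ndb dx
      t2 = t [ ld j ≔ stal ]
      C2 : t2 cC ≡ stal
      C2 = trans (upd-neq t {ld j} stal {cC} (λ ())) tC
      A2 : t2 cA ≡ stal
      A2 = trans (upd-neq t {ld j} stal {cA} (λ ())) tA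
      nd : ∀ v → t2 v ≡ free → ¬ DomWin (t2 [ v ≔ dom ])
      nd v fv dw with v ≟V lb j
      ... | no ne with dw (ld j)
      ...   | x , hx , dx with N[ld]-cases j x hx
      ...     | inj₁ refl = stal≢dom (trans (sym (upd-keeps t2 {v} dom {ld j} fv (upd-eq t (ld j) stal) stal≢free)) dx)
      ...     | inj₂ (inj₁ refl) = stal≢dom (trans (sym (upd-keeps t2 {v} dom {cC} fv C2 stal≢free)) dx)
      ...     | inj₂ (inj₂ refl) = ndb (trans (sym (trans (upd-neq t2 {v} dom {lb j} (≢-sym ne)) (upd-neq t {ld j} stal {lb j} (λ ())))) dx)
      nd v fv dw | yes refl with any? (λ k → owner-≟ (t (ld k)) dom)
      ...   | yes (k , ldk) with dw (la k)
      ...     | x , hx , dx with N[la]-cases k x hx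
      ...       | inj₁ refl = sameCol ldk refl (λ ()) (trans (sym (trans (upd-neq t2 {lb j} dom {la k} (λ ())) (upd-neq t {ld j} stal {la k} (λ ())))) dx)
      ...       | inj₂ (inj₁ refl) = stal≢dom (trans (sym (upd-keeps t2 {lb j} dom {cA} fv A2 stal≢free)) dx)
      ...       | inj₂ (inj₂ refl) = sameCol ldk refl (λ ()) (trans (sym (trans (upd-neq t2 {lb j} dom {lb k} kj) (upd-neq t {ld j} stal {lb k} (λ ())))) dx)
        where kj : lb k ≢ lb j
              kj e = ndd (subst (λ z → t (ld z) ≡ dom) (lb-inj e) ldk)
      nd v fv dw | yes refl | no nld with dw cC
      ...     | x , hx , dx with N[C]-cases x hx
      ...       | inj₁ refl = stal≢dom (trans (sym (upd-keeps t2 {lb j} dom {cC} fv C2 stal≢free)) dx)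
      ...       | inj₂ (inj₁ refl) = ndB (trans (sym (trans (upd-neq t2 {lb j} dom {cB} (λ ())) (upd-neq t {ld j} stal {cB} (λ ())))) dx)
      ...       | inj₂ (inj₂ (k , refl)) with upd-cases t (ld j) stal (ld k)
      ...         | inj₁ (_ , q) = stal≢dom (trans (sym q) (trans (sym (upd-neq t2 {lb j} dom {ld k} (λ ()))) dx))
      ...         | inj₂ (_ , q) = nld (k , trans (sym q) (trans (sym (upd-neq t2 {lb j} dom {ld k} (λ ()))) dx))
      step : ∀ v → t2 v ≡ free → ¬ DomWin (t2 [ v ≔ dom ]) × NotSTurn 0 (t2 [ v ≔ dom ])
      step v fv = nd v fv , fv0 (v ≟V cB)
        where
        fv0 : Dec (v ≡ cB) → NotSTurn 0 (t2 [ v ≔ dom ])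
        fv0 (yes e) = lb j , trans (upd-neq t2 {v} dom {lb j} (λ q → lb≢cB j (trans q e))) (trans (upd-neq t {ld j} stal {lb j} (λ ())) fb) , inj₂ (λ ())
        fv0 (no ne) = cB , trans (upd-neq t2 {v} dom {cB} (≢-sym ne)) (trans (upd-neq t {ld j} stal {cB} (λ ())) fB) , inj₂ (λ ())

    r3 : (∀ j → t (la j) ≢ dom) → (∀ j → t (ld j) ≢ dom) → ¬ DomWin t × NotSTurn 1 t
    r3 nla nld = ndw , cB , fB , inj₂ (¬DTurn-suc step)
      where
      ndw : ¬ DomWin t
      ndw dw with dw cA
      ... | x , hx , dx with N[A]-cases x hx
      ...   | inj₁ refl = stal≢dom (trans (sym tA) dx)
      ...   | inj₂ (inj₁ refl) = ndB dx
      ...   | inj₂ (inj₂ (k , refl)) = nla k dx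
      t2 = t [ cB ≔ stal ]
      step : ∀ v → t2 v ≡ free → ¬ DomWin (t2 [ v ≔ dom ]) × NotSTurn 0 (t2 [ v ≔ dom ])
      step v fv = nd (view v) , fv0 (v ≟V la j0)
        where
        B3 : (t2 [ v ≔ dom ]) cB ≡ stal
        B3 = upd-keeps t2 {v} dom {cB} fv (upd-eq t cB stal) stal≢free
        A3 : (t2 [ v ≔ dom ]) cA ≡ stal
        A3 = upd-keeps t2 {v} dom {cA} fv tA stal≢free
        C3 : (t2 [ v ≔ dom ]) cC ≡ stal
        C3 = upd-keeps t2 {v} dom {cC} fv tC stal≢free
        viaA : (∀ k' → la k' ≢ v) → ¬ DomWin (t2 [ v ≔ dom ])
        viaA notla dw with dw cA
        ... | x , hx , dx with N[A]-cases x hx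
        ...   | inj₁ refl = stal≢dom (trans (sym A3) dx)
        ...   | inj₂ (inj₁ refl) = stal≢dom (trans (sym B3) dx)
        ...   | inj₂ (inj₂ (k' , refl)) = nla k' (trans (sym (upd-neq t2 {v} dom {la k'} (notla k'))) dx)
        nd : VView v → ¬ DomWin (t2 [ v ≔ dom ])
        nd (isa k) dw with dw cC
        ... | x , hx , dx with N[C]-cases x hx
        ...   | inj₁ refl = stal≢dom (trans (sym C3) dx)
        ...   | inj₂ (inj₁ refl) = stal≢dom (trans (sym B3) dx)
        ...   | inj₂ (inj₂ (k' , refl)) = nld k' (trans (sym (trans (upd-neq t2 {la k} dom {ld k'} (λ ())) refl)) dx)
        nd isA = viaA (λ k' ())
        nd isB = viaA (λ k' ())
        nd isC = viaA (λ k' ())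
        nd (isb k) = viaA (λ k' ())
        nd (isd k) = viaA (λ k' ())
        fv0 : Dec (v ≡ la j0) → NotSTurn 0 (t2 [ v ≔ dom ])
        fv0 (yes e) = la j1 , trans (upd-neq t2 {v} dom {la j1} (λ q → la1≢la0 (trans q e))) (fr (la j1) (nla j1) (λ ()) (λ ())) , inj₂ (λ ())
        fv0 (no ne) = la j0 , trans (upd-neq t2 {v} dom {la j0} (≢-sym ne)) (fr (la j0) (nla j0) (λ ()) (λ ())) , inj₂ (λ ())

  three-column-endgame : ∀ (t : State) → t cA ≡ stal → t cC ≡ stal → (∀ u → t u ≡ stal → u ≡ cA ⊎ u ≡ cC) →
            (∀ u → t u ≡ dom → proj₂ u ≢ fz) → (∀ u u' → t u ≡ dom → t u' ≡ dom → proj₂ u ≡ proj₂ u' → u ≡ u') →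
            ¬ DomWin t × NotSTurn 1 t
  three-column-endgame t tA tC tst nocen uc with any? (λ j → owner-≟ (t (la j)) dom)
  ... | yes (j , e) = ThreeColumnEndgame.r1 t tA tC tst nocen uc j e
  ... | no nla with any? (λ j → owner-≟ (t (ld j)) dom)
  ...   | no nld = ThreeColumnEndgame.r3 t tA tC tst nocen uc (λ j e → nla (j , e)) (λ j e → nld (j , e))
  ...   | yes (j , e) with ThreeColumnEndgame.r1 (t ∘σ) tC tA tst' (λ u e' → nocen (σ u) e') uc' j e
    where
    tst' : ∀ u → t (σ u) ≡ stal → u ≡ cA ⊎ u ≡ cC
    tst' u e' with tst (σ u) e'
    ... | inj₁ q = inj₂ (trans (sym (σinv u)) (cong σ q))
    ... | inj₂ q = inj₁ (trans (sym (σinv u)) (cong σ q))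
    uc' : ∀ u u' → t (σ u) ≡ dom → t (σ u') ≡ dom → proj₂ u ≡ proj₂ u' → u ≡ u'
    uc' u u' d d' q = σ-inj (uc (σ u) (σ u') d d' q)
  ...     | ndw' , nst' = (λ dw → ndw' (DomWin-σ dw)) , NotSTurn-σ 1 (≗-sym (∘σ-∘σ t)) nst'

  Hits : Fin n → Fin (suc n) → Fin (suc n) → Fin (suc n) → Set
  Hits j a b c = fs j ≡ a ⊎ fs j ≡ b ⊎ fs j ≡ c

  FirstThree : Fin (suc n) → Set
  FirstThree a = a ≡ fs j0 ⊎ a ≡ fs j1 ⊎ a ≡ fs j2

  FirstThreeDistinct : Fin (suc n) → Fin (suc n) → Fin (suc n) → Set
  FirstThreeDistinct a b c = FirstThree a × FirstThree b × FirstThree c × a ≢ b × a ≢ c × b ≢ c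

  hits-first-three : ∀ {a b c} → Hits j0 a b c → Hits j1 a b c → Hits j2 a b c → FirstThreeDistinct a b c
  hits-first-three (inj₁ refl) (inj₁ ()) (inj₁ ())
  hits-first-three (inj₁ refl) (inj₁ ()) (inj₂ (inj₁ refl))
  hits-first-three (inj₁ refl) (inj₁ ()) (inj₂ (inj₂ refl))
  hits-first-three (inj₁ refl) (inj₂ (inj₁ refl)) (inj₁ ())
  hits-first-three (inj₁ refl) (inj₂ (inj₁ refl)) (inj₂ (inj₁ ()))
  hits-first-three (inj₁ refl) (inj₂ (inj₁ refl)) (inj₂ (inj₂ refl)) = inj₁ refl , inj₂ (inj₁ refl) , inj₂ (inj₂ refl) , (λ ()) , (λ ()) , (λ ())
  hits-first-three (inj₁ refl) (inj₂ (inj₂ refl)) (inj₁ ())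
  hits-first-three (inj₁ refl) (inj₂ (inj₂ refl)) (inj₂ (inj₁ refl)) = inj₁ refl , inj₂ (inj₂ refl) , inj₂ (inj₁ refl) , (λ ()) , (λ ()) , (λ ())
  hits-first-three (inj₁ refl) (inj₂ (inj₂ refl)) (inj₂ (inj₂ ()))
  hits-first-three (inj₂ (inj₁ refl)) (inj₁ refl) (inj₁ ())
  hits-first-three (inj₂ (inj₁ refl)) (inj₁ refl) (inj₂ (inj₁ ()))
  hits-first-three (inj₂ (inj₁ refl)) (inj₁ refl) (inj₂ (inj₂ refl)) = inj₂ (inj₁ refl) , inj₁ refl , inj₂ (inj₂ refl) , (λ ()) , (λ ()) , (λ ())
  hits-first-three (inj₂ (inj₁ refl)) (inj₂ (inj₁ ())) (inj₁ refl)
  hits-first-three (inj₂ (inj₁ refl)) (inj₂ (inj₁ ())) (inj₂ (inj₁ ()))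
  hits-first-three (inj₂ (inj₁ refl)) (inj₂ (inj₁ ())) (inj₂ (inj₂ refl))
  hits-first-three (inj₂ (inj₁ refl)) (inj₂ (inj₂ refl)) (inj₁ refl) = inj₂ (inj₂ refl) , inj₁ refl , inj₂ (inj₁ refl) , (λ ()) , (λ ()) , (λ ())
  hits-first-three (inj₂ (inj₁ refl)) (inj₂ (inj₂ refl)) (inj₂ (inj₁ ()))
  hits-first-three (inj₂ (inj₁ refl)) (inj₂ (inj₂ refl)) (inj₂ (inj₂ ()))
  hits-first-three (inj₂ (inj₂ refl)) (inj₁ refl) (inj₁ ())
  hits-first-three (inj₂ (inj₂ refl)) (inj₁ refl) (inj₂ (inj₁ refl)) = inj₂ (inj₁ refl) , inj₂ (inj₂ refl) , inj₁ refl , (λ ()) , (λ ()) , (λ ())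
  hits-first-three (inj₂ (inj₂ refl)) (inj₁ refl) (inj₂ (inj₂ ()))
  hits-first-three (inj₂ (inj₂ refl)) (inj₂ (inj₁ refl)) (inj₁ refl) = inj₂ (inj₂ refl) , inj₂ (inj₁ refl) , inj₁ refl , (λ ()) , (λ ()) , (λ ())
  hits-first-three (inj₂ (inj₂ refl)) (inj₂ (inj₁ refl)) (inj₂ (inj₁ ()))
  hits-first-three (inj₂ (inj₂ refl)) (inj₂ (inj₁ refl)) (inj₂ (inj₂ ()))
  hits-first-three (inj₂ (inj₂ refl)) (inj₂ (inj₂ ())) (inj₁ refl)
  hits-first-three (inj₂ (inj₂ refl)) (inj₂ (inj₂ ())) (inj₂ (inj₁ refl))
  hits-first-three (inj₂ (inj₂ refl)) (inj₂ (inj₂ ())) (inj₂ (inj₂ ()))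

  FirstThree-≢fz : ∀ {a} → FirstThree a → a ≢ fz
  FirstThree-≢fz (inj₁ refl) ()
  FirstThree-≢fz (inj₂ (inj₁ refl)) ()
  FirstThree-≢fz (inj₂ (inj₂ refl)) ()

  FirstThree-≢fourth : ∀ (x : Fin m) {a} → FirstThree a → fs (fs (fs (fs x))) ≢ a
  FirstThree-≢fourth x (inj₁ refl) ()
  FirstThree-≢fourth x (inj₂ (inj₁ refl)) ()
  FirstThree-≢fourth x (inj₂ (inj₂ refl)) ()

  hits : ∀ j a b c → ¬ (fs j ≢ a × fs j ≢ b × fs j ≢ c) → Hits j a b c
  hits j a b c h with fs j ≟F a | fs j ≟F b | fs j ≟F c
  ... | yes e | _ | _ = inj₁ e
  ... | no _ | yes e | _ = inj₂ (inj₁ e)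
  ... | no _ | no _ | yes e = inj₂ (inj₂ e)
  ... | no x | no y | no z = ⊥-elim (h (x , y , z))

  A-C-¬DTurn : ∀ s p q → s cA ≡ stal → s cC ≡ stal → (∀ u → s u ≡ dom → u ≡ p ⊎ u ≡ q) →
       (∀ u → s u ≡ stal → u ≡ cA ⊎ u ≡ cC) → ¬ DTurn (suc (suc m)) s
  A-C-¬DTurn s p q sA sC hd hs = ¬DTurn-suc step
    where
    step : ∀ v → s v ≡ free → ¬ DomWin (s [ v ≔ dom ]) × NotSTurn (suc m) (s [ v ≔ dom ])
    step v fv = main (any? (λ z → ¬? (fs z ≟F proj₂ p) ×-dec ¬? (fs z ≟F proj₂ q) ×-dec ¬? (fs z ≟F proj₂ v)))
      where
      t = s [ v ≔ dom ]
      tA : t cA ≡ stal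
      tA = upd-keeps s {v} dom {cA} fv sA stal≢free
      tC : t cC ≡ stal
      tC = upd-keeps s {v} dom {cC} fv sC stal≢free
      tdom : ∀ u → t u ≡ dom → u ≡ p ⊎ u ≡ q ⊎ u ≡ v
      tdom u e with upd-cases s v dom u
      ... | inj₁ (q' , _) = inj₂ (inj₂ q')
      ... | inj₂ (_ , r) with hd u (trans (sym r) e)
      ...   | inj₁ x = inj₁ x
      ...   | inj₂ x = inj₂ (inj₁ x)
      tst : ∀ u → t u ≡ stal → u ≡ cA ⊎ u ≡ cC
      tst u e = hs u (upd-stal-dom s v u e)
      tfree : ∀ u → proj₂ u ≢ proj₂ p → proj₂ u ≢ proj₂ q → proj₂ u ≢ proj₂ v → proj₂ u ≢ fz → t u ≡ free
      tfree u np nq nv nz = owner-free (t u) nd ns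
        where nd : t u ≢ dom
              nd e with tdom u e
              ... | inj₁ refl = np refl
              ... | inj₂ (inj₁ refl) = nq refl
              ... | inj₂ (inj₂ refl) = nv refl
              ns : t u ≢ stal
              ns e with tst u e
              ... | inj₁ refl = nz refl
              ... | inj₂ refl = nz refl
      main : Dec (∃ λ z → fs z ≢ proj₂ p × fs z ≢ proj₂ q × fs z ≢ proj₂ v) → ¬ DomWin t × NotSTurn (suc m) t
      main (yes (z , np , nq , nv)) = ndw , lb z , fb , inj₂ (double-threat-¬DTurn (suc m) th1 th2 (λ ()))
        where
        fa = tfree (la z) np nq nv (λ ())
        fb = tfree (lb z) np nq nv (λ ())
        fd = tfree (ld z) np nq nv (λ ())
        ndw : ¬ DomWin t
        ndw dw with dw (la z)
        ... | x , hx , dx with N[la]-cases z x hx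
        ...   | inj₁ refl = free≢dom (trans (sym fa) dx)
        ...   | inj₂ (inj₁ refl) = stal≢dom (trans (sym tA) dx)
        ...   | inj₂ (inj₂ refl) = free≢dom (trans (sym fb) dx)
        t' = t [ lb z ≔ stal ]
        th1 : Threat t' (la z) (la z)
        th1 = trans (upd-neq t {lb z} stal {la z} (λ ())) fa , λ u hu → case (N[la]-cases z u hu)
          where case : ∀ {u} → u ≡ la z ⊎ u ≡ cA ⊎ u ≡ lb z → u ≡ la z ⊎ t' u ≡ stal
                case (inj₁ e) = inj₁ e
                case (inj₂ (inj₁ refl)) = inj₂ (trans (upd-neq t {lb z} stal {cA} (λ ())) tA)
                case (inj₂ (inj₂ refl)) = inj₂ (upd-eq t (lb z) stal)
        th2 : Threat t' (ld z) (ld z)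
        th2 = trans (upd-neq t {lb z} stal {ld z} (λ ())) fd , λ u hu → case (N[ld]-cases z u hu)
          where case : ∀ {u} → u ≡ ld z ⊎ u ≡ cC ⊎ u ≡ lb z → u ≡ ld z ⊎ t' u ≡ stal
                case (inj₁ e) = inj₁ e
                case (inj₂ (inj₁ refl)) = inj₂ (trans (upd-neq t {lb z} stal {cC} (λ ())) tC)
                case (inj₂ (inj₂ refl)) = inj₂ (upd-eq t (lb z) stal)
      main (no h) = fin m refl
        where
        a = proj₂ p
        b = proj₂ q
        c = proj₂ v
        hit : ∀ j → Hits j a b c
        hit j = hits j a b c (λ x → h (j , x))
        P = hits-first-three (hit j0) (hit j1) (hit j2)
        nocen : ∀ u → t u ≡ dom → proj₂ u ≢ fz
        nocen u e with tdom u e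
        ... | inj₁ refl = FirstThree-≢fz (proj₁ P)
        ... | inj₂ (inj₁ refl) = FirstThree-≢fz (proj₁ (proj₂ P))
        ... | inj₂ (inj₂ refl) = FirstThree-≢fz (proj₁ (proj₂ (proj₂ P)))
        ab = proj₁ (proj₂ (proj₂ (proj₂ P)))
        ac = proj₁ (proj₂ (proj₂ (proj₂ (proj₂ P))))
        bc = proj₂ (proj₂ (proj₂ (proj₂ (proj₂ P))))
        uc : ∀ u u' → t u ≡ dom → t u' ≡ dom → proj₂ u ≡ proj₂ u' → u ≡ u'
        uc u u' e e' eq with tdom u e | tdom u' e'
        ... | inj₁ refl | inj₁ refl = refl
        ... | inj₂ (inj₁ refl) | inj₂ (inj₁ refl) = refl
        ... | inj₂ (inj₂ refl) | inj₂ (inj₂ refl) = refl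
        ... | inj₁ refl | inj₂ (inj₁ refl) = ⊥-elim (ab eq)
        ... | inj₁ refl | inj₂ (inj₂ refl) = ⊥-elim (ac eq)
        ... | inj₂ (inj₁ refl) | inj₁ refl = ⊥-elim (ab (sym eq))
        ... | inj₂ (inj₁ refl) | inj₂ (inj₂ refl) = ⊥-elim (bc eq)
        ... | inj₂ (inj₂ refl) | inj₁ refl = ⊥-elim (ac (sym eq))
        ... | inj₂ (inj₂ refl) | inj₂ (inj₁ refl) = ⊥-elim (bc (sym eq))
        fin : ∀ m' → m' ≡ m → ¬ DomWin t × NotSTurn (suc m) t
        fin zero refl = three-column-endgame t tA tC tst nocen uc
        fin (suc m') e with hit (fs (fs (fs (subst Fin e fz))))
        ... | inj₁ q' = ⊥-elim (FirstThree-≢fourth (subst Fin e fz) (proj₁ P) q')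
        ... | inj₂ (inj₁ q') = ⊥-elim (FirstThree-≢fourth (subst Fin e fz) (proj₁ (proj₂ P)) q')
        ... | inj₂ (inj₂ q') = ⊥-elim (FirstThree-≢fourth (subst Fin e fz) (proj₁ (proj₂ (proj₂ P))) q')

  after-A : ∀ v1 → v1 ≢ cA → v1 ≢ cC →
           NotSTurn (suc (suc m)) (((empty [ v1 ≔ dom ]) [ cA ≔ stal ]) [ cC ≔ dom ]) →
           ¬ DTurn n ((empty [ v1 ≔ dom ]) [ cA ≔ stal ])
  after-A v1 v1A v1C chainCase = ¬DTurn-suc step2
    where
    w0 = empty [ v1 ≔ dom ]
    w1 = w0 [ cA ≔ stal ]
    A1 : w1 cA ≡ stal
    A1 = upd-eq w0 cA stal
    C1 : w1 cC ≡ free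
    C1 = trans (upd-neq w0 {cA} stal {cC} (λ ())) (trans (upd-neq empty {v1} dom {cC} (≢-sym v1C)) refl)
    step2 : ∀ v2 → w1 v2 ≡ free → ¬ DomWin (w1 [ v2 ≔ dom ]) × NotSTurn (suc (suc m)) (w1 [ v2 ≔ dom ])
    step2 v2 fv2 = ndw , ns (v2 ≟V cC)
      where
      w2 = w1 [ v2 ≔ dom ]
      k = proj₁ (fresh-column (proj₂ v1) (proj₂ v2))
      k1 = proj₁ (proj₂ (fresh-column (proj₂ v1) (proj₂ v2)))
      k2 = proj₂ (proj₂ (fresh-column (proj₂ v1) (proj₂ v2)))
      rd2 : ∀ u → proj₂ u ≢ proj₂ v1 → proj₂ u ≢ proj₂ v2 → u ≢ cA → w2 u ≡ free
      rd2 u a b c = trans (upd-neq w1 {v2} dom {u} (column-≢ b)) (trans (upd-neq w0 {cA} stal {u} c) (trans (upd-neq empty {v1} dom {u} (column-≢ a)) refl))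
      A2 : w2 cA ≡ stal
      A2 = upd-keeps w1 {v2} dom {cA} fv2 A1 stal≢free
      ndw : ¬ DomWin w2
      ndw dw with dw (la k)
      ... | x , hx , dx with N[la]-cases k x hx
      ...   | inj₁ refl = free≢dom (trans (sym (rd2 (la k) k1 k2 (λ ()))) dx)
      ...   | inj₂ (inj₁ refl) = stal≢dom (trans (sym A2) dx)
      ...   | inj₂ (inj₂ refl) = free≢dom (trans (sym (rd2 (lb k) k1 k2 (λ ()))) dx)
      ns : Dec (v2 ≡ cC) → NotSTurn (suc (suc m)) w2
      ns (yes e) = subst (λ z → NotSTurn (suc (suc m)) (w1 [ z ≔ dom ])) (sym e) chainCase
      ns (no ne) = cC , trans (upd-neq w1 {v2} dom {cC} (≢-sym ne)) C1 , inj₂ (A-C-¬DTurn w3 v1 v2 A3 (upd-eq w2 cC stal) hd hs)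
        where
        w3 = w2 [ cC ≔ stal ]
        A3 : w3 cA ≡ stal
        A3 = trans (upd-neq w2 {cC} stal {cA} (λ ())) A2
        hd : ∀ u → w3 u ≡ dom → u ≡ v1 ⊎ u ≡ v2
        hd u e with upd-cases w2 cC stal u
        ... | inj₁ (_ , r) = ⊥-elim (stal≢dom (trans (sym r) e))
        ... | inj₂ (_ , r) with upd-cases w1 v2 dom u
        ...   | inj₁ (q , _) = inj₂ q
        ...   | inj₂ (_ , r') with upd-cases w0 cA stal u
        ...     | inj₁ (_ , r'') = ⊥-elim (stal≢dom (trans (sym r'') (trans (sym r') (trans (sym r) e))))
        ...     | inj₂ (_ , r'') with upd-cases empty v1 dom u
        ...       | inj₁ (q , _) = inj₁ q
        ...       | inj₂ (_ , r''') = ⊥-elim (empty-nd u (trans (sym r''') (trans (sym r'') (trans (sym r') (trans (sym r) e)))))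
        hs : ∀ u → w3 u ≡ stal → u ≡ cA ⊎ u ≡ cC
        hs u e with upd-stal w2 cC stal u e
        ... | inj₁ q = inj₂ q
        ... | inj₂ q with upd-stal w0 cA stal u (upd-stal-dom w1 v2 u q)
        ...   | inj₁ q' = inj₁ q'
        ...   | inj₂ q' = ⊥-elim (empty-nstal u (upd-stal-dom empty v1 u q'))

  la-¬dom : ∀ (s : State) x j → s (la j) ≢ dom → (s [ x ≔ stal ]) (la j) ≢ dom
  la-¬dom s x j nd = upd-ndom s x stal (la j) stal≢dom nd

  answer-A : NotSTurn n (empty [ cA ≔ dom ])
  answer-A = ld j0 , refl , inj₂ (ld-chain-¬DTurn (suc (suc m)) s j0 (punchIn j0) refl refl refl nd (upd-eq (empty [ cA ≔ dom ]) (ld j0) stal) refl refl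
                         (λ i → punchInᵢ≢i j0 i) (punchIn-injective j0)
                         (λ i → refl , refl , trans (upd-neq (empty [ cA ≔ dom ]) {ld j0} stal {ld (punchIn j0 i)} (λ e → punchInᵢ≢i j0 i (ld-inj e))) refl))
    where
    s = (empty [ cA ≔ dom ]) [ ld j0 ≔ stal ]
    nd : ∀ j → s (ld j) ≢ dom
    nd j = upd-ndom (empty [ cA ≔ dom ]) (ld j0) stal (ld j) stal≢dom (λ ())

  answer-B : NotSTurn (suc (suc m)) (((empty [ cB ≔ dom ]) [ cA ≔ stal ]) [ cC ≔ dom ])
  answer-B = la j0 , refl , inj₂ (subst (λ z → ¬ DTurn z s) (+-identityʳ (suc (suc m)))
         (threat-chain-¬DTurn (suc (suc m)) 0 s j0 (punchIn j0) refl (upd-eq (((empty [ cB ≔ dom ]) [ cA ≔ stal ]) [ cC ≔ dom ]) (la j0) stal) refl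
            (λ i → punchInᵢ≢i j0 i) (punchIn-injective j0)
            (λ i → trans (upd-neq (((empty [ cB ≔ dom ]) [ cA ≔ stal ]) [ cC ≔ dom ]) {la j0} stal {la (punchIn j0 i)} (λ e → punchInᵢ≢i j0 i (la-inj e))) refl , refl)
            no-extra))
    where s = (((empty [ cB ≔ dom ]) [ cA ≔ stal ]) [ cC ≔ dom ]) [ la j0 ≔ stal ]

  answer-lb : ∀ c → NotSTurn (suc (suc m)) (((empty [ lb c ≔ dom ]) [ cA ≔ stal ]) [ cC ≔ dom ])
  answer-lb c = la k , refl ,
         inj₂ (subst (λ z → ¬ DTurn z s) (+-comm (suc m) 1)
           (threat-chain-¬DTurn (suc m) 1 s k os refl (upd-eq s0 (la k) stal)
              (trans (upd-neq empty {lb c} dom {lb k} (λ e → punchInᵢ≢i c fz (lb-inj e))) refl)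
              nt (λ i j e → suc-injective (punchIn-injective c (fs i) (fs j) e))
              (λ i → trans (upd-neq s0 {la k} stal {la (os i)} (λ e → nt i (la-inj e))) refl ,
                     trans (upd-neq empty {lb c} dom {lb (os i)} (λ e → punchInᵢ≢i c (fs i) (lb-inj e))) refl)
              (extra refl (λ j → la-¬dom s0 (la k) j (λ e → free≢dom (trans (sym (trans (upd-neq empty {lb c} dom {la j} (λ ())) refl)) e))))))
    where
    k = punchIn c fz
    os : Fin (suc m) → Fin n
    os i = punchIn c (fs i)
    nt : ∀ i → os i ≢ k
    nt i e with punchIn-injective c (fs i) fz e
    ... | ()
    s0 = ((empty [ lb c ≔ dom ]) [ cA ≔ stal ]) [ cC ≔ dom ]
    s = s0 [ la k ≔ stal ]

  answer-ld : ∀ c → NotSTurn (suc (suc m)) (((empty [ ld c ≔ dom ]) [ cA ≔ stal ]) [ cC ≔ dom ])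
  answer-ld c = la j0 , refl ,
         inj₂ (¬DTurn-≤ (suc (suc m) + 1) (m≤m+n (suc (suc m)) 1)
           (threat-chain-¬DTurn (suc (suc m)) 1 s j0 (punchIn j0) refl (upd-eq s0 (la j0) stal) refl
              (λ i → punchInᵢ≢i j0 i) (punchIn-injective j0)
              (λ i → trans (upd-neq s0 {la j0} stal {la (punchIn j0 i)} (λ e → punchInᵢ≢i j0 i (la-inj e))) refl , refl)
              (extra refl (λ j → la-¬dom s0 (la j0) j (λ ())))))
    where
    s0 = ((empty [ ld c ≔ dom ]) [ cA ≔ stal ]) [ cC ≔ dom ]
    s = s0 [ la j0 ≔ stal ]

  staller-survives-D-game : ¬ DTurn (suc n) empty
  staller-survives-D-game = ¬DTurn-suc step1
    where
    step1 : ∀ v → empty v ≡ free → ¬ DomWin (empty [ v ≔ dom ]) × NotSTurn n (empty [ v ≔ dom ])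
    step1 v fv with view v
    ... | isA = single-dom-¬DomWin empty cA (ld j0) empty-nd (na-d-A j0) , answer-A
    ... | isB = single-dom-¬DomWin empty cB (la j0) empty-nd (na-a-B j0) , cA , refl , inj₂ (after-A cB (λ ()) (λ ()) answer-B)
    ... | isb c = single-dom-¬DomWin empty (lb c) cA empty-nd (na-A-b c) , cA , refl , inj₂ (after-A (lb c) (λ ()) (λ ()) (answer-lb c))
    ... | isd c = single-dom-¬DomWin empty (ld c) cA empty-nd (na-A-d c) , cA , refl , inj₂ (after-A (ld c) (λ ()) (λ ()) (answer-ld c))
    ... | isC = single-dom-¬DomWin empty cC (la j0) empty-nd (na-a-C j0) , NotSTurn-σ n (upd-∘σ empty cC dom) answer-A
    ... | isa c = single-dom-¬DomWin empty (la c) (ld j0) empty-nd (na-d-a j0 c) ,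
                  NotSTurn-σ n (upd-∘σ empty (la c) dom) (cA , refl , inj₂ (after-A (ld c) (λ ()) (λ ()) (answer-ld c)))

theorem4p4 : (n : ℕ) → 3 ≤ n →
    γMB≡ (P₃ □ K₁ n) (n + 2) × γ'SMB≡ (P₃ □ K₁ n) (n + 2)
theorem4p4 (suc (suc (suc m))) (s≤s (s≤s (s≤s z≤n))) =
  subst (γMB≡ G) (+-comm 2 n)
    (γMB≡-from-bounds (suc n) dominator-wins-D-game staller-survives-D-game) ,
  subst (γ'SMB≡ G) (+-comm 2 n)
    (γ'SMB≡-from-bounds (suc n) staller-wins-S-game dominator-survives-S-game)
  where open WideBoard m
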